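{- For every $n\ge 3$ and $1\le k\le n-1$, $R_{n,k}=E_{n-1,k}$. Consequently $R_n=E_{n-1}$ for all $n\ge 3$; that is, the permutations of length $n\ge 3$ with rev-tier $n-2$ form an Entringer family.
   Context: Sorting procedure: a permutation $\pi$ is processed using an input sequence (initially $\pi_1,\ldots,\pi_n$), a stack and an output. Let $m$ be the smallest value not yet output. At each step: if the stack's top entry equals $m$, pop it to the output; otherwise, if the input is nonempty, push the next input entry onto the stack. When no move is possible and the stack is nonempty, the remaining stack entries are returned to the input in the reverse of their order in the previous input (i.e. listed from top of stack to bottom), and the procedure is repeated. The rev-tier of $\pi$ is the number of times entries must be returned to the input before the output is $1,2,\ldots,n$. $R_n$ is the number of permutations of length $n$ with rev-tier $n-2$, and $R_{n,k}$ is the number of those in which the entry $1$ is in position $k+1$. An alternating (down/up) permutation of $[n]$ is one with $\pi_1>\pi_2<\pi_3>\pi_4<\cdots$. The Entringer number $E_{n,k}$ is the number of alternating permutations of $[n]$ beginning with $k$, and the Euler number is $E_n=\sum_{k=1}^n E_{n,k}$. -}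

module Defs where

open import Data.Nat using (ℕ; zero; suc; _+_; _∸_; _<_; _>_; _≟_; _<?_)
open import Data.Nat.Properties using ()
open import Data.List using (List; []; _∷_; length; filter; concatMap; map; upTo)
open import Data.Nat.ListAction using (sum)
open import Data.Maybe using (Maybe; just; nothing)
import Data.Maybe.Properties as MaybeP
open import Data.Product using (_×_; _,_)
open import Data.Unit using (⊤)
open import Data.Empty using (⊥)
open import Relation.Nullary using (Dec; yes; no)
open import Relation.Binary.PropositionalEquality using (_≡_)
open import Relation.Unary using (Pred; Decidable)
open import Level using (0ℓ)

-- Permutations of [n] = {1,…,n}, as lists π₁ … πₙ (one-line notation).

insertAll : ℕ → List ℕ → List (List ℕ)
insertAll x []       = (x ∷ []) ∷ []
insertAll x (y ∷ ys) = (x ∷ y ∷ ys) ∷ map (y ∷_) (insertAll x ys)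

perms : ℕ → List (List ℕ)
perms zero    = [] ∷ []
perms (suc n) = concatMap (insertAll (suc n)) (perms n)

count : {A : Set} {P : Pred A 0ℓ} → Decidable P → List A → ℕ
count P? xs = length (filter P? xs)

-- The sorting procedure.  The stack is a list with its top at the head;
-- m is the smallest value not yet output.

popAll : List ℕ → ℕ → List ℕ × ℕ
popAll []       m = [] , m
popAll (x ∷ st) m with x ≟ m
... | yes _ = popAll st (suc m)
... | no  _ = x ∷ st , m

pass : List ℕ → List ℕ → ℕ → List ℕ × ℕ
pass []       st m = popAll st m
pass (x ∷ xs) st m with popAll st m
... | st' , m' = pass xs (x ∷ st') m'

-- The stack entries are returned listed from top to bottom, i.e. the
-- stack list itself becomes the new input.  `fuel` bounds the number of
-- passes; `nothing` means the fuel ran out.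
returns : ℕ → List ℕ → ℕ → Maybe ℕ
returns zero       inp m = nothing
returns (suc fuel) inp m with pass inp [] m
... | []     , _  = just 0
... | x ∷ st , m' with returns fuel (x ∷ st) m'
...   | just r  = just (suc r)
...   | nothing = nothing

-- rev-tier of π (values 1..n); every pass outputs at least one entry,
-- so length π + 1 passes always suffice.
revTier : List ℕ → Maybe ℕ
revTier π = returns (suc (length π)) π 1

nth : List ℕ → ℕ → Maybe ℕ
nth []       _       = nothing
nth (x ∷ xs) zero    = just x
nth (x ∷ xs) (suc i) = nth xs i

hasRevTier? : (t : ℕ) → Decidable (λ (π : List ℕ) → revTier π ≡ just t)
hasRevTier? t π = MaybeP.≡-dec _≟_ (revTier π) (just t)

R : ℕ → ℕ
R n = count (hasRevTier? (n ∸ 2)) (perms n)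

-- entry 1 in position k+1 (1-indexed), i.e. index k (0-indexed)
revTierOneAt? : (t k : ℕ) → Decidable (λ (π : List ℕ) → (revTier π ≡ just t) × (nth π k ≡ just 1))
revTierOneAt? t k π with hasRevTier? t π | MaybeP.≡-dec _≟_ (nth π k) (just 1)
... | yes p | yes q = yes (p , q)
... | no ¬p | _     = no λ { (p , _) → ¬p p }
... | yes _ | no ¬q = no λ { (_ , q) → ¬q q }

Rk : ℕ → ℕ → ℕ
Rk n k = count (revTierOneAt? (n ∸ 2) k) (perms n)

data Down : List ℕ → Set
data Up   : List ℕ → Set
data Down where
  d[]  : Down []
  d[x] : ∀ {x} → Down (x ∷ [])
  d∷   : ∀ {x y ys} → x > y → Up (y ∷ ys) → Down (x ∷ y ∷ ys)
data Up where
  u[]  : Up []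
  u[x] : ∀ {x} → Up (x ∷ [])
  u∷   : ∀ {x y ys} → x < y → Down (y ∷ ys) → Up (x ∷ y ∷ ys)

down? : Decidable Down
up?   : Decidable Up
down? []           = yes d[]
down? (x ∷ [])     = yes d[x]
down? (x ∷ y ∷ ys) with y <? x | up? (y ∷ ys)
... | yes p | yes q = yes (d∷ p q)
... | no ¬p | _     = no λ { (d∷ p _) → ¬p p }
... | yes _ | no ¬q = no λ { (d∷ _ q) → ¬q q }
up? []           = yes u[]
up? (x ∷ [])     = yes u[x]
up? (x ∷ y ∷ ys) with x <? y | down? (y ∷ ys)
... | yes p | yes q = yes (u∷ p q)
... | no ¬p | _     = no λ { (u∷ p _) → ¬p p }
... | yes _ | no ¬q = no λ { (u∷ _ q) → ¬q q }

Alternating : List ℕ → Set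
Alternating = Down

startsWith? : (k : ℕ) → Decidable (λ (π : List ℕ) → Alternating π × (nth π 0 ≡ just k))
startsWith? k π with down? π | MaybeP.≡-dec _≟_ (nth π 0) (just k)
... | yes p | yes q = yes (p , q)
... | no ¬p | _     = no λ { (p , _) → ¬p p }
... | yes _ | no ¬q = no λ { (_ , q) → ¬q q }

Entringer : ℕ → ℕ → ℕ
Entringer n k = count (startsWith? k) (perms n)

Euler : ℕ → ℕ
Euler n = sum (map (λ i → Entringer n (suc i)) (upTo n))

module Submission where

-- Both sides satisfy the same boustrophedon-type recurrences, each obtained by
-- decomposing the permutations of [n+1] bijectively into pairs (i, σ) with i ≤ n
-- and σ a permutation of [n] (CountByBijection):
--  * prependFirst i σ = (i+1) followed by σ standardised above i.  A down-up
--    permutation starting with i+1 corresponds to an up-down σ starting below i+1,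
--    so E_{n+1,i+1} = Σ_{1≤j≤i} U_{n,j} and symmetrically U_{n+1,i+1} = Σ_{i<j≤n} E_{n,j},
--    where U_{n,j} counts up-down permutations starting with j.
--  * insertOne i τ = 1 inserted at index i into τ reversed with all values raised.
--    Its first pass outputs only 1, leaving exactly the raised τ on the stack, iff
--    1 lands at least two places after 2; then rev-tier(π) = 1 + rev-tier(τ).
--    Otherwise 1 and 2 are both output and rev-tier(π) < n - 1, since every later
--    pass outputs at least one entry.  Hence R_{n+1,k} = Σ_{n+1-k ≤ j < n} R_{n,j}.
-- Induction on n then gives R_{n+1,k} = E_{n,k} and R_{n+1,n+1-j} = U_{n,j} together;
-- summing over the position of 1 gives R_{n+1} = E_n.

open import Defs
open import Data.Nat using (ℕ; zero; suc; _+_; _∸_; _≤_; _<_; _≟_; _≤?_; _<?_; z≤n; s≤s; pred)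
import Data.Nat.Properties as ℕP
open import Data.Bool using (true; false)
open import Data.List using (List; []; _∷_; _++_; length; filter; map; concatMap; reverse; upTo; applyUpTo; [_])
import Data.List.Properties as LP
open import Data.List.Membership.Propositional using (_∈_; _∉_; find; lose)
import Data.List.Membership.Propositional.Properties as MP
open import Data.List.Membership.Propositional.Properties.WithK using (unique∧set⇒bag)
open import Data.List.Relation.Unary.Any using (here; there)
open import Data.List.Relation.Unary.All using (All; []; _∷_)
import Data.List.Relation.Unary.All as All
import Data.List.Relation.Unary.All.Properties as AllP
open import Data.List.Relation.Unary.Unique.Propositional using (Unique)
open import Data.List.Relation.Unary.AllPairs using ([]; _∷_)
import Data.List.Relation.Unary.Unique.Propositional.Properties as UP
open import Data.List.Relation.Binary.Permutation.Propositional using (↭⇒↭ₛ; _↭_; ↭-refl; ↭-prep; ↭-swap; ↭-sym; ↭-trans; ↭-reflexive)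
import Data.List.Relation.Binary.Permutation.Propositional.Properties as PP
open import Data.List.Relation.Binary.BagAndSetEquality using (∼bag⇒↭)
open import Data.Nat.ListAction using (sum)
open import Data.Maybe using (Maybe; just; nothing)
import Data.Maybe as Maybe
import Data.Maybe.Properties as MaybeP
open import Data.Product using (Σ; _×_; _,_; proj₁; proj₂)
open import Data.Sum using (_⊎_; inj₁; inj₂; [_,_]′)
open import Data.Empty using (⊥; ⊥-elim)
open import Data.Unit using (⊤; tt)
open import Relation.Nullary using (¬_; yes; no; does)
open import Relation.Nullary.Decidable using (_×-dec_)
open import Relation.Binary.Definitions using (tri<; tri≈; tri>)
open import Relation.Unary using (Pred; Decidable)
open import Relation.Binary.PropositionalEquality using (_≡_; _≢_; setoid; refl; sym; trans; cong; cong₂; subst; subst₂; module ≡-Reasoning)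
import Data.List.Relation.Binary.Permutation.Setoid.Properties (setoid ℕ) as SP
open import Function using (_∘_; id)
open import Function.Bundles using (_⇔_; mk⇔; Equivalence)
open import Level using (0ℓ)
open import Algebra.Properties.CommutativeSemigroup ℕP.+-commutativeSemigroup using () renaming (interchange to +-interchange)

module _ {A : Set} where

  indicator : {P : Pred A 0ℓ} → Decidable P → A → ℕ
  indicator P? x with does (P? x)
  ... | true  = 1
  ... | false = 0

  count-∷ : {P : Pred A 0ℓ} (P? : Decidable P) (x : A) (xs : List A) →
            count P? (x ∷ xs) ≡ indicator P? x + count P? xs
  count-∷ P? x xs with P? x
  ... | yes _ = refl
  ... | no  _ = refl

  indicator-yes : {P : Pred A 0ℓ} (P? : Decidable P) {x : A} → P x → indicator P? x ≡ 1
  indicator-yes P? {x} p with P? x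
  ... | yes _ = refl
  ... | no ¬p = ⊥-elim (¬p p)

  indicator-no : {P : Pred A 0ℓ} (P? : Decidable P) {x : A} → ¬ P x → indicator P? x ≡ 0
  indicator-no P? {x} ¬p with P? x
  ... | yes p = ⊥-elim (¬p p)
  ... | no _  = refl

  indicator-⇔ : {P Q : Pred A 0ℓ} (P? : Decidable P) (Q? : Decidable Q) {x : A} →
                P x ⇔ Q x → indicator P? x ≡ indicator Q? x
  indicator-⇔ P? Q? {x} P⇔Q with Q? x
  ... | yes q = indicator-yes P? (Equivalence.from P⇔Q q)
  ... | no ¬q = indicator-no P? (λ p → ¬q (Equivalence.to P⇔Q p))

  indicator-⊎ : {P Q R : Pred A 0ℓ} (P? : Decidable P) (Q? : Decidable Q) (R? : Decidable R) {x : A} →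
                (P x → Q x ⊎ R x) → (Q x → P x) → (R x → P x) → (Q x → R x → ⊥) →
                indicator P? x ≡ indicator Q? x + indicator R? x
  indicator-⊎ P? Q? R? {x} split fromQ fromR disjoint with Q? x | R? x
  ... | yes q | yes r = ⊥-elim (disjoint q r)
  ... | yes q | no _  = indicator-yes P? (fromQ q)
  ... | no _  | yes r = indicator-yes P? (fromR r)
  ... | no ¬q | no ¬r = indicator-no P? λ p → [ ¬q , ¬r ]′ (split p)

  count-+ : {P Q R : Pred A 0ℓ} (P? : Decidable P) (Q? : Decidable Q) (R? : Decidable R) (xs : List A) →
            (∀ x → x ∈ xs → indicator P? x ≡ indicator Q? x + indicator R? x) →
            count P? xs ≡ count Q? xs + count R? xs
  count-+ P? Q? R? [] h = refl
  count-+ P? Q? R? (x ∷ xs) h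
    rewrite count-∷ P? x xs | count-∷ Q? x xs | count-∷ R? x xs
          | h x (here refl) | count-+ P? Q? R? xs (λ y y∈ → h y (there y∈))
    = +-interchange (indicator Q? x) (indicator R? x) (count Q? xs) (count R? xs)

  count-cong : {P Q : Pred A 0ℓ} (P? : Decidable P) (Q? : Decidable Q) (xs : List A) →
               (∀ x → x ∈ xs → indicator P? x ≡ indicator Q? x) → count P? xs ≡ count Q? xs
  count-cong P? Q? [] h = refl
  count-cong P? Q? (x ∷ xs) h
    rewrite count-∷ P? x xs | count-∷ Q? x xs | h x (here refl)
          | count-cong P? Q? xs (λ y y∈ → h y (there y∈)) = refl

  count-⇔ : {P Q : Pred A 0ℓ} (P? : Decidable P) (Q? : Decidable Q) (xs : List A) →
            (∀ x → x ∈ xs → P x ⇔ Q x) → count P? xs ≡ count Q? xs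
  count-⇔ P? Q? xs h = count-cong P? Q? xs λ x x∈ → indicator-⇔ P? Q? (h x x∈)

  count-none : {P : Pred A 0ℓ} (P? : Decidable P) (xs : List A) →
               (∀ x → x ∈ xs → ¬ P x) → count P? xs ≡ 0
  count-none P? [] h = refl
  count-none P? (x ∷ xs) h
    rewrite count-∷ P? x xs | indicator-no P? (h x (here refl)) = count-none P? xs (λ y y∈ → h y (there y∈))

  count-++ : {P : Pred A 0ℓ} (P? : Decidable P) (xs ys : List A) →
             count P? (xs ++ ys) ≡ count P? xs + count P? ys
  count-++ P? xs ys = trans (cong length (LP.filter-++ P? xs ys)) (LP.length-++ (filter P? xs))

  count-↭ : {P : Pred A 0ℓ} (P? : Decidable P) {xs ys : List A} → xs ↭ ys → count P? xs ≡ count P? ys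
  count-↭ P? p = PP.↭-length (PP.filter-↭ P? p)

  count-sameEntries : {P : Pred A 0ℓ} (P? : Decidable P) (xs ys : List A) → Unique xs → Unique ys →
                      (∀ z → z ∈ xs → z ∈ ys) → (∀ z → z ∈ ys → z ∈ xs) → count P? xs ≡ count P? ys
  count-sameEntries P? xs ys ux uy f g =
    count-↭ P? (∼bag⇒↭ (unique∧set⇒bag ux uy (mk⇔ (f _) (g _))))

count-map : {A B : Set} {P : Pred B 0ℓ} (P? : Decidable P) (f : A → B) (xs : List A) →
            count P? (map f xs) ≡ count (λ x → P? (f x)) xs
count-map P? f [] = refl
count-map P? f (x ∷ xs) with P? (f x)
... | yes _ = cong suc (count-map P? f xs)
... | no _  = count-map P? f xs

count-concatMap : {A B : Set} {P : Pred B 0ℓ} (P? : Decidable P) (g : A → List B) (xs : List A) →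
                  count P? (concatMap g xs) ≡ sum (map (λ a → count P? (g a)) xs)
count-concatMap P? g [] = refl
count-concatMap P? g (x ∷ xs) =
  trans (count-++ P? (g x) (concatMap g xs)) (cong (count P? (g x) +_) (count-concatMap P? g xs))

sumBelow : (ℕ → ℕ) → ℕ → ℕ
sumBelow f zero    = 0
sumBelow f (suc n) = sumBelow f n + f n

sumBelow-head : ∀ f n → sumBelow f (suc n) ≡ f 0 + sumBelow (f ∘ suc) n
sumBelow-head f zero    = ℕP.+-comm 0 (f 0)
sumBelow-head f (suc n) rewrite sumBelow-head f n = ℕP.+-assoc (f 0) _ _

sum-applyUpTo : ∀ (f g : ℕ → ℕ) n → sum (map f (applyUpTo g n)) ≡ sumBelow (f ∘ g) n
sum-applyUpTo f g zero    = refl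
sum-applyUpTo f g (suc n) rewrite sum-applyUpTo f (g ∘ suc) n = sym (sumBelow-head (f ∘ g) n)

sum-upTo : ∀ (f : ℕ → ℕ) n → sum (map f (upTo n)) ≡ sumBelow f n
sum-upTo f = sum-applyUpTo f id

sumBelow-cong : ∀ f g n → (∀ i → i < n → f i ≡ g i) → sumBelow f n ≡ sumBelow g n
sumBelow-cong f g zero    h = refl
sumBelow-cong f g (suc n) h =
  cong₂ _+_ (sumBelow-cong f g n (λ i i< → h i (ℕP.m≤n⇒m≤1+n i<))) (h n ℕP.≤-refl)

sumBelow-zero : ∀ f n → (∀ i → i < n → f i ≡ 0) → sumBelow f n ≡ 0
sumBelow-zero f zero    h = refl
sumBelow-zero f (suc n) h =
  cong₂ _+_ (sumBelow-zero f n (λ i i< → h i (ℕP.m≤n⇒m≤1+n i<))) (h n ℕP.≤-refl)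

sumBelow-single : ∀ f n c → c < n → (∀ i → i < n → i ≢ c → f i ≡ 0) → sumBelow f n ≡ f c
sumBelow-single f (suc n) c c<sn h with c ≟ n
... | yes refl = cong (_+ f c) (sumBelow-zero f c (λ i i< → h i (ℕP.m≤n⇒m≤1+n i<) (ℕP.<⇒≢ i<)))
... | no c≢n   = trans (cong₂ _+_ (sumBelow-single f n c (ℕP.≤∧≢⇒< (ℕP.≤-pred c<sn) c≢n)
                                                     (λ i i< → h i (ℕP.m≤n⇒m≤1+n i<)))
                                  (h n ℕP.≤-refl (λ e → c≢n (sym e))))
                       (ℕP.+-identityʳ _)

sumRange : (ℕ → ℕ) → ℕ → ℕ → ℕ
sumRange f a b = sumBelow (λ i → f (a + i)) (b ∸ a)

suc-∸ : ∀ {m n} → n ≤ m → suc m ∸ n ≡ suc (m ∸ n)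
suc-∸ = ℕP.+-∸-assoc 1

∸-suc : ∀ {m n} → n < m → m ∸ n ≡ suc (m ∸ suc n)
∸-suc {suc m} (s≤s n≤m) = suc-∸ n≤m

sumRange-snoc : ∀ f a b → a ≤ b → sumRange f a (suc b) ≡ sumRange f a b + f b
sumRange-snoc f a b a≤b rewrite suc-∸ a≤b = cong (sumRange f a b +_) (cong f (ℕP.m+[n∸m]≡n a≤b))

sumRange-cons : ∀ f a b → a < b → sumRange f a b ≡ f a + sumRange f (suc a) b
sumRange-cons f a (suc b) (s≤s a≤b) rewrite suc-∸ a≤b =
  trans (sumBelow-head (λ i → f (a + i)) (b ∸ a))
        (cong₂ _+_ (cong f (ℕP.+-identityʳ a))
                   (sumBelow-cong (λ i → f (a + suc i)) (λ i → f (suc a + i)) (b ∸ a)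
                                  (λ i _ → cong f (ℕP.+-suc a i))))

sumRange-cong : ∀ f g a b → (∀ j → a ≤ j → j < b → f j ≡ g j) → sumRange f a b ≡ sumRange g a b
sumRange-cong f g a b h = sumBelow-cong (λ i → f (a + i)) (λ i → g (a + i)) (b ∸ a)
                            (λ i i< → h (a + i) (ℕP.m≤m+n a i) (+-<-∸ i<))
  where
  +-<-∸ : ∀ {i} → i < b ∸ a → a + i < b
  +-<-∸ {i} i< = subst (a + i <_) (ℕP.m+[n∸m]≡n {a} {b} (ℕP.<⇒≤ (ℕP.m∸n≢0⇒n<m (ℕP.m<n⇒n≢0 i<)))) (ℕP.+-monoʳ-< a i<)

sumRange-empty : ∀ f a → sumRange f a a ≡ 0
sumRange-empty f a rewrite ℕP.n∸n≡0 a = refl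

sumRange-reflect : ∀ f c a d → a + d ≤ suc c →
                   sumRange (λ j → f (c ∸ j)) a (a + d) ≡ sumRange f (suc c ∸ (a + d)) (suc c ∸ a)
sumRange-reflect f c a zero h rewrite ℕP.+-identityʳ a =
  trans (sumRange-empty (λ j → f (c ∸ j)) a) (sym (sumRange-empty f (suc c ∸ a)))
sumRange-reflect f c a (suc d) h rewrite ℕP.+-suc a d =
  begin
    sumRange g a (suc (a + d))
  ≡⟨ sumRange-snoc g a (a + d) (ℕP.m≤m+n a d) ⟩
    sumRange g a (a + d) + f (c ∸ (a + d))
  ≡⟨ cong (_+ f (c ∸ (a + d))) (sumRange-reflect f c a d (ℕP.m≤n⇒m≤1+n a+d≤c)) ⟩
    sumRange f (suc c ∸ (a + d)) (suc c ∸ a) + f (c ∸ (a + d))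
  ≡⟨ ℕP.+-comm _ (f (c ∸ (a + d))) ⟩
    f (c ∸ (a + d)) + sumRange f (suc c ∸ (a + d)) (suc c ∸ a)
  ≡⟨ cong (λ z → f (c ∸ (a + d)) + sumRange f z (suc c ∸ a)) (suc-∸ a+d≤c) ⟩
    f (c ∸ (a + d)) + sumRange f (suc (c ∸ (a + d))) (suc c ∸ a)
  ≡⟨ sumRange-cons f (c ∸ (a + d)) (suc c ∸ a) lower<upper ⟨
    sumRange f (c ∸ (a + d)) (suc c ∸ a)
  ∎
  where
  open ≡-Reasoning
  g : ℕ → ℕ
  g j = f (c ∸ j)
  a+d≤c : a + d ≤ c
  a+d≤c = ℕP.≤-pred h
  lower<upper : c ∸ (a + d) < suc c ∸ a
  lower<upper rewrite suc-∸ {c} {a} (ℕP.≤-trans (ℕP.m≤m+n a d) a+d≤c) = s≤s (ℕP.∸-monoʳ-≤ c (ℕP.m≤m+n a d))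

module Statistic {A : Set} {Q : Pred A 0ℓ} (Q? : Decidable Q) (f : A → ℕ) where

  ValueIn : ℕ → ℕ → Pred A 0ℓ
  ValueIn a b x = Q x × (a ≤ f x × f x < b)

  valueIn? : ∀ a b → Decidable (ValueIn a b)
  valueIn? a b x = Q? x ×-dec ((a ≤? f x) ×-dec (f x <? b))

  Value : ℕ → Pred A 0ℓ
  Value j x = Q x × f x ≡ j

  value? : ∀ j → Decidable (Value j)
  value? j x = Q? x ×-dec (f x ≟ j)

  count-valueIn : ∀ xs a b → a ≤ b → count (valueIn? a b) xs ≡ sumRange (λ j → count (value? j) xs) a b
  count-valueIn xs a b a≤b =
    subst (λ c → count (valueIn? a c) xs ≡ sumRange (λ j → count (value? j) xs) a c)
          (ℕP.m+[n∸m]≡n a≤b) (byLength (b ∸ a))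
    where
    splitLast : ∀ d {x} → ValueIn a (suc (a + d)) x → ValueIn a (a + d) x ⊎ Value (a + d) x
    splitLast d {x} (q , a≤ , <suc) with f x ≟ a + d
    ... | yes e = inj₂ (q , e)
    ... | no ne = inj₁ (q , a≤ , ℕP.≤∧≢⇒< (ℕP.≤-pred <suc) ne)

    byLength : ∀ d → count (valueIn? a (a + d)) xs ≡ sumRange (λ j → count (value? j) xs) a (a + d)
    byLength zero =
      trans (count-none (valueIn? a (a + 0)) xs
               (λ x _ (_ , a≤ , <a) → ℕP.<-irrefl refl (ℕP.≤-trans <a (ℕP.≤-trans (ℕP.≤-reflexive (ℕP.+-identityʳ a)) a≤))))
            (sym (subst (λ c → sumRange (λ j → count (value? j) xs) a c ≡ 0) (sym (ℕP.+-identityʳ a))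
                        (sumRange-empty (λ j → count (value? j) xs) a)))
    byLength (suc d) rewrite ℕP.+-suc a d =
      trans (count-+ (valueIn? a (suc (a + d))) (valueIn? a (a + d)) (value? (a + d)) xs
               (λ x _ → indicator-⊎ (valueIn? a (suc (a + d))) (valueIn? a (a + d)) (value? (a + d))
                   (splitLast d)
                   (λ { (q , a≤ , <) → q , a≤ , ℕP.m≤n⇒m≤1+n < })
                   (λ { (q , e) → q , subst (a ≤_) (sym e) (ℕP.m≤m+n a d) , subst (_< suc (a + d)) (sym e) ℕP.≤-refl })
                   (λ { (_ , _ , <) (_ , e) → ℕP.<-irrefl e < })))
            (trans (cong (_+ count (value? (a + d)) xs) (byLength d))
                   (sym (sumRange-snoc (λ j → count (value? j) xs) a (a + d) (ℕP.m≤m+n a d))))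

interval : ℕ → ℕ → List ℕ
interval a zero    = []
interval a (suc L) = a ∷ interval (suc a) L

IsPerm : ℕ → List ℕ → Set
IsPerm n π = π ↭ interval 1 n

interval-snoc : ∀ a L → interval a (suc L) ≡ interval a L ++ [ a + L ]
interval-snoc a zero    = cong [_] (sym (ℕP.+-identityʳ a))
interval-snoc a (suc L) =
  cong (a ∷_) (trans (interval-snoc (suc a) L) (cong (λ z → interval (suc a) L ++ [ z ]) (sym (ℕP.+-suc a L))))

interval-length : ∀ a L → length (interval a L) ≡ L
interval-length a zero    = refl
interval-length a (suc L) = cong suc (interval-length (suc a) L)

interval-∈⁻ : ∀ {x} a L → x ∈ interval a L → a ≤ x × x < a + L
interval-∈⁻ a (suc L) (here refl) = ℕP.≤-refl , subst (a <_) (sym (ℕP.+-suc a L)) (s≤s (ℕP.m≤m+n a L))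
interval-∈⁻ {x} a (suc L) (there m) with interval-∈⁻ (suc a) L m
... | a< , <end = ℕP.<⇒≤ a< , subst (x <_) (sym (ℕP.+-suc a L)) <end

interval-∈⁺ : ∀ {x} a L → a ≤ x → x < a + L → x ∈ interval a L
interval-∈⁺ {x} a zero a≤ <a+0 =
  ⊥-elim (ℕP.<-irrefl refl (ℕP.≤-trans <a+0 (ℕP.≤-trans (ℕP.≤-reflexive (ℕP.+-identityʳ a)) a≤)))
interval-∈⁺ {x} a (suc L) a≤ <end with a ≟ x
... | yes refl = here refl
... | no a≢x   = there (interval-∈⁺ (suc a) L (ℕP.≤∧≢⇒< a≤ a≢x) (subst (x <_) (ℕP.+-suc a L) <end))

interval-unique : ∀ a L → Unique (interval a L)
interval-unique a zero    = []
interval-unique a (suc L) =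
  All.tabulate (λ m e → ℕP.<-irrefl e (proj₁ (interval-∈⁻ (suc a) L m))) ∷ interval-unique (suc a) L

perm-∈⁻ : ∀ {n π x} → IsPerm n π → x ∈ π → 1 ≤ x × x < suc n
perm-∈⁻ {n} p m = interval-∈⁻ 1 n (PP.∈-resp-↭ p m)

perm-∈⁺ : ∀ {n π x} → IsPerm n π → 1 ≤ x → x < suc n → x ∈ π
perm-∈⁺ {n} p 1≤ <suc = PP.∈-resp-↭ (↭-sym p) (interval-∈⁺ 1 n 1≤ <suc)

perm-unique : ∀ {n π} → IsPerm n π → Unique π
perm-unique p = SP.Unique-resp-↭ (↭⇒↭ₛ (↭-sym p)) (interval-unique 1 _)

perm-length : ∀ {n π} → IsPerm n π → length π ≡ n
perm-length {n} p = trans (PP.↭-length p) (interval-length 1 n)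

mkPerm : ∀ n π → Unique π → (∀ x → x ∈ π → 1 ≤ x × x < suc n) → (∀ x → 1 ≤ x → x < suc n → x ∈ π) →
         IsPerm n π
mkPerm n π u sound complete = ∼bag⇒↭ (unique∧set⇒bag u (interval-unique 1 n)
  (mk⇔ (λ m → let 1≤ , <suc = sound _ m in interval-∈⁺ 1 n 1≤ <suc)
       (λ m → let 1≤ , <suc = interval-∈⁻ 1 n m in complete _ 1≤ <suc)))

splitAtOne : ∀ {n} π → IsPerm n π → 1 ≤ n →
             Σ (List ℕ) λ A → Σ (List ℕ) λ C → π ≡ A ++ 1 ∷ C × All (_≢ 1) A × All (_≢ 1) C
splitAtOne {n} π p 1≤n with MP.∈-∃++ (perm-∈⁺ {x = 1} p ℕP.≤-refl (s≤s 1≤n))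
... | A , C , refl = A , C , refl , unique-split A C (perm-unique p)
  where
  unique-split : ∀ A C → Unique (A ++ 1 ∷ C) → All (_≢ 1) A × All (_≢ 1) C
  unique-split [] C (fresh ∷ _) = [] , All.map (λ ne e → ne (sym e)) fresh
  unique-split (y ∷ A) C (fresh ∷ u) with unique-split A C u
  ... | notA , notC = All.lookup fresh (MP.∈-++⁺ʳ A (here refl)) ∷ notA , notC

unique-map : {A B : Set} (f : A → B) (xs : List A) → Unique xs →
             (∀ x y → x ∈ xs → y ∈ xs → f x ≡ f y → x ≡ y) → Unique (map f xs)
unique-map f [] _ _ = []
unique-map f (x ∷ xs) (x∉ ∷ u) inj =
  All.tabulate (λ {z} m e → distinct z m e) ∷ unique-map f xs u (λ a b ma mb → inj a b (there ma) (there mb))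
  where
  distinct : ∀ z → z ∈ map f xs → f x ≢ z
  distinct z m e with MP.∈-map⁻ f m
  ... | y , y∈ , refl = All.lookup x∉ y∈ (inj x y (here refl) (there y∈) e)

unique-concatMap : {A B : Set} (g : A → List B) (as : List A) → Unique as → (∀ a → a ∈ as → Unique (g a)) →
                   (∀ a a' b → a ∈ as → a' ∈ as → b ∈ g a → b ∈ g a' → a ≡ a') → Unique (concatMap g as)
unique-concatMap g [] _ _ _ = []
unique-concatMap g (a ∷ as) (a∉ ∷ u) ug inj =
  UP.++⁺ (ug a (here refl))
         (unique-concatMap g as u (λ a' m → ug a' (there m)) (λ a₁ a₂ b m₁ m₂ → inj a₁ a₂ b (there m₁) (there m₂)))
         disjoint
  where
  disjoint : ∀ {v} → ¬ (v ∈ g a × v ∈ concatMap g as)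
  disjoint {v} (v∈ga , v∈rest) with find (MP.∈-concatMap⁻ g {xs = as} v∈rest)
  ... | a' , a'∈ , v∈ga' = All.lookup a∉ a'∈ (inj a a' v (here refl) (there a'∈) v∈ga v∈ga')

insertAll-↭ : ∀ x σ τ → τ ∈ insertAll x σ → τ ↭ x ∷ σ
insertAll-↭ x [] τ (here refl) = ↭-refl
insertAll-↭ x (y ∷ ys) τ (here refl) = ↭-refl
insertAll-↭ x (y ∷ ys) τ (there τ∈) with MP.∈-map⁻ (y ∷_) τ∈
... | τ' , τ'∈ , refl = ↭-trans (↭-prep y (insertAll-↭ x ys τ' τ'∈)) (↭-swap y x ↭-refl)

insertAll-∈ : ∀ x A B → A ++ x ∷ B ∈ insertAll x (A ++ B)
insertAll-∈ x [] [] = here refl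
insertAll-∈ x [] (b ∷ B) = here refl
insertAll-∈ x (a ∷ A) B = there (MP.∈-map⁺ (a ∷_) (insertAll-∈ x A B))

interval-suc : ∀ n → suc n ∷ interval 1 n ↭ interval 1 (suc n)
interval-suc n = ↭-trans (PP.∷↭∷ʳ (suc n) (interval 1 n)) (↭-reflexive (sym (interval-snoc 1 n)))

perms-sound : ∀ n π → π ∈ perms n → IsPerm n π
perms-sound zero π (here refl) = ↭-refl
perms-sound (suc n) π π∈ with find (MP.∈-concatMap⁻ (insertAll (suc n)) {xs = perms n} π∈)
... | σ , σ∈ , π∈' =
  ↭-trans (insertAll-↭ (suc n) σ π π∈') (↭-trans (↭-prep (suc n) (perms-sound n σ σ∈)) (interval-suc n))

perms-complete : ∀ n π → IsPerm n π → π ∈ perms n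
perms-complete zero π p rewrite PP.↭-empty-inv p = here refl
perms-complete (suc n) π p
  with MP.∈-∃++ (PP.∈-resp-↭ (↭-sym p) (subst (suc n ∈_) (sym (interval-snoc 1 n)) (MP.∈-++⁺ʳ (interval 1 n) (here refl))))
... | A , B , refl =
  MP.∈-concatMap⁺ (insertAll (suc n)) (lose (perms-complete n (A ++ B) rest) (insertAll-∈ (suc n) A B))
  where
  rest : A ++ B ↭ interval 1 n
  rest = subst (A ++ B ↭_) (LP.++-identityʳ (interval 1 n))
               (PP.drop-mid A (interval 1 n) (↭-trans p (↭-reflexive (interval-snoc 1 n))))

insertAll-unique : ∀ x σ → x ∉ σ → Unique (insertAll x σ)
insertAll-unique x [] _ = [] ∷ []
insertAll-unique x (y ∷ ys) x∉ =
  All.tabulate distinct ∷ UP.map⁺ (λ { refl → refl }) (insertAll-unique x ys (λ m → x∉ (there m)))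
  where
  distinct : ∀ {τ} → τ ∈ map (y ∷_) (insertAll x ys) → x ∷ y ∷ ys ≢ τ
  distinct m e with MP.∈-map⁻ (y ∷_) m
  distinct m refl | τ' , _ , refl = x∉ (here refl)

delete : ℕ → List ℕ → List ℕ
delete x [] = []
delete x (y ∷ ys) with y ≟ x
... | yes _ = ys
... | no _  = y ∷ delete x ys

delete-insertAll : ∀ x σ τ → x ∉ σ → τ ∈ insertAll x σ → delete x τ ≡ σ
delete-insertAll x [] τ _ (here refl) with x ≟ x
... | yes _ = refl
... | no ne = ⊥-elim (ne refl)
delete-insertAll x (y ∷ ys) τ _ (here refl) with x ≟ x
... | yes _ = refl
... | no ne = ⊥-elim (ne refl)
delete-insertAll x (y ∷ ys) τ x∉ (there m) with MP.∈-map⁻ (y ∷_) m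
... | τ' , τ'∈ , refl with y ≟ x
... | yes refl = ⊥-elim (x∉ (here refl))
... | no _     = cong (y ∷_) (delete-insertAll x ys τ' (λ m → x∉ (there m)) τ'∈)

perms-unique : ∀ n → Unique (perms n)
perms-unique zero    = [] ∷ []
perms-unique (suc n) = unique-concatMap (insertAll (suc n)) (perms n) (perms-unique n)
  (λ σ σ∈ → insertAll-unique (suc n) σ (fresh σ∈))
  (λ σ σ' τ m m' t t' → trans (sym (delete-insertAll (suc n) σ τ (fresh m) t))
                              (delete-insertAll (suc n) σ' τ (fresh m') t'))
  where
  fresh : ∀ {σ} → σ ∈ perms n → suc n ∉ σ
  fresh σ∈ m = ℕP.<-irrefl refl (proj₂ (perm-∈⁻ (perms-sound n _ σ∈) m))

module CountByBijection (n : ℕ) (B : ℕ → List ℕ → List ℕ)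
  (B-perm : ∀ i σ → i < suc n → IsPerm n σ → IsPerm (suc n) (B i σ))
  (B-inj : ∀ i j σ τ → i < suc n → j < suc n → IsPerm n σ → IsPerm n τ → B i σ ≡ B j τ → i ≡ j × σ ≡ τ)
  (B-surj : ∀ π → IsPerm (suc n) π → Σ ℕ λ i → Σ (List ℕ) λ σ → i < suc n × IsPerm n σ × B i σ ≡ π) where

  image : List (List ℕ)
  image = concatMap (λ i → map (B i) (perms n)) (upTo (suc n))

  image-complete : ∀ π → π ∈ perms (suc n) → π ∈ image
  image-complete π m with B-surj π (perms-sound (suc n) π m)
  ... | i , σ , i< , p , refl =
    MP.∈-concatMap⁺ (λ i → map (B i) (perms n)) (lose (MP.∈-upTo⁺ i<) (MP.∈-map⁺ (B i) (perms-complete n σ p)))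

  image-sound : ∀ π → π ∈ image → π ∈ perms (suc n)
  image-sound π m with find (MP.∈-concatMap⁻ (λ i → map (B i) (perms n)) {xs = upTo (suc n)} m)
  ... | i , i∈ , π∈ with MP.∈-map⁻ (B i) π∈
  ... | σ , σ∈ , refl = perms-complete (suc n) _ (B-perm i σ (MP.∈-upTo⁻ i∈) (perms-sound n σ σ∈))

  image-unique : Unique image
  image-unique = unique-concatMap (λ i → map (B i) (perms n)) (upTo (suc n)) (UP.upTo⁺ (suc n))
    (λ i i∈ → unique-map (B i) (perms n) (perms-unique n)
        (λ σ τ σ∈ τ∈ e → proj₂ (B-inj i i σ τ (MP.∈-upTo⁻ i∈) (MP.∈-upTo⁻ i∈) (perms-sound n σ σ∈) (perms-sound n τ τ∈) e)))
    sameIndex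
    where
    sameIndex : ∀ i j π → i ∈ upTo (suc n) → j ∈ upTo (suc n) → π ∈ map (B i) (perms n) → π ∈ map (B j) (perms n) → i ≡ j
    sameIndex i j π i∈ j∈ πi πj with MP.∈-map⁻ (B i) πi | MP.∈-map⁻ (B j) πj
    ... | σ , σ∈ , e₁ | τ , τ∈ , e₂ =
      proj₁ (B-inj i j σ τ (MP.∈-upTo⁻ i∈) (MP.∈-upTo⁻ j∈) (perms-sound n σ σ∈) (perms-sound n τ τ∈) (trans (sym e₁) e₂))

  count-byBijection : {P : Pred (List ℕ) 0ℓ} (P? : Decidable P) →
                      count P? (perms (suc n)) ≡ sumBelow (λ i → count (λ σ → P? (B i σ)) (perms n)) (suc n)
  count-byBijection P? =
    begin
      count P? (perms (suc n))
    ≡⟨ count-sameEntries P? (perms (suc n)) image (perms-unique (suc n)) image-unique image-complete image-sound ⟩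
      count P? image
    ≡⟨ count-concatMap P? (λ i → map (B i) (perms n)) (upTo (suc n)) ⟩
      sum (map (λ i → count P? (map (B i) (perms n))) (upTo (suc n)))
    ≡⟨ cong sum (LP.map-cong (λ i → count-map P? (B i) (perms n)) (upTo (suc n))) ⟩
      sum (map (λ i → count (λ σ → P? (B i σ)) (perms n)) (upTo (suc n)))
    ≡⟨ sum-upTo (λ i → count (λ σ → P? (B i σ)) (perms n)) (suc n) ⟩
      sumBelow (λ i → count (λ σ → P? (B i σ)) (perms n)) (suc n)
    ∎
    where
    open ≡-Reasoning

  count-byBijection-at : {P : Pred (List ℕ) 0ℓ} (P? : Decidable P) (c : ℕ) → c < suc n →
                         (∀ j σ → j < suc n → IsPerm n σ → P (B j σ) → j ≡ c) →
                         count P? (perms (suc n)) ≡ count (λ σ → P? (B c σ)) (perms n)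
  count-byBijection-at P? c c< forced =
    trans (count-byBijection P?)
          (sumBelow-single _ (suc n) c c<
             (λ j j< j≢c → count-none (λ σ → P? (B j σ)) (perms n)
                             (λ σ σ∈ h → j≢c (forced j σ j< (perms-sound n σ σ∈) h))))

shiftAbove : ℕ → ℕ → ℕ
shiftAbove i x with x ≤? i
... | yes _ = x
... | no _  = suc x

unshiftAbove : ℕ → ℕ → ℕ
unshiftAbove i y with y ≤? i
... | yes _ = y
... | no _  = pred y

shiftAbove-≤ : ∀ {i x} → x ≤ i → shiftAbove i x ≡ x
shiftAbove-≤ {i} {x} le with x ≤? i
... | yes _  = refl
... | no nle = ⊥-elim (nle le)

shiftAbove-> : ∀ {i x} → i < x → shiftAbove i x ≡ suc x
shiftAbove-> {i} {x} lt with x ≤? i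
... | yes le = ⊥-elim (ℕP.<⇒≱ lt le)
... | no _   = refl

unshiftAbove-≤ : ∀ {i y} → y ≤ i → unshiftAbove i y ≡ y
unshiftAbove-≤ {i} {y} le with y ≤? i
... | yes _  = refl
... | no nle = ⊥-elim (nle le)

unshiftAbove-> : ∀ {i y} → i < y → unshiftAbove i y ≡ pred y
unshiftAbove-> {i} {y} lt with y ≤? i
... | yes le = ⊥-elim (ℕP.<⇒≱ lt le)
... | no _   = refl

shiftAbove-mono : ∀ i {x y} → x < y → shiftAbove i x < shiftAbove i y
shiftAbove-mono i {x} {y} lt with x ≤? i | y ≤? i
... | yes _ | yes _ = lt
... | yes _ | no _  = ℕP.m≤n⇒m≤1+n lt
... | no x≰ | yes y≤ = ⊥-elim (x≰ (ℕP.≤-trans (ℕP.<⇒≤ lt) y≤))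
... | no _  | no _  = s≤s lt

shiftAbove-reflects : ∀ i {x y} → shiftAbove i x < shiftAbove i y → x < y
shiftAbove-reflects i {x} {y} lt with x <? y
... | yes x<y = x<y
... | no x≮y with ℕP.m≤n⇒m<n∨m≡n (ℕP.≮⇒≥ x≮y)
...   | inj₁ y<x  = ⊥-elim (ℕP.<-asym lt (shiftAbove-mono i y<x))
...   | inj₂ refl = ⊥-elim (ℕP.<-irrefl refl lt)

shiftAbove-injective : ∀ i {x y} → shiftAbove i x ≡ shiftAbove i y → x ≡ y
shiftAbove-injective i {x} {y} e with ℕP.<-cmp x y
... | tri< x<y _ _ = ⊥-elim (ℕP.<⇒≢ (shiftAbove-mono i x<y) e)
... | tri≈ _ x≡y _ = x≡y
... | tri> _ _ y<x = ⊥-elim (ℕP.<⇒≢ (shiftAbove-mono i y<x) (sym e))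

shiftAbove-skips : ∀ i x → shiftAbove i x ≢ suc i
shiftAbove-skips i x e with x ≤? i
... | yes le  = ℕP.<-irrefl e (s≤s le)
... | no nle  = nle (ℕP.≤-reflexive (ℕP.suc-injective e))

shiftAbove-unshiftAbove : ∀ i y → y ≢ suc i → shiftAbove i (unshiftAbove i y) ≡ y
shiftAbove-unshiftAbove i y ne with i <? y
... | no i≮y rewrite unshiftAbove-≤ (ℕP.≮⇒≥ i≮y) = shiftAbove-≤ (ℕP.≮⇒≥ i≮y)
shiftAbove-unshiftAbove i zero    ne | yes ()
shiftAbove-unshiftAbove i (suc y) ne | yes i<y rewrite unshiftAbove-> {i} {suc y} i<y =
  shiftAbove-> (ℕP.≤∧≢⇒< (ℕP.≤-pred i<y) (λ e → ne (cong suc (sym e))))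

unshiftAbove-shiftAbove : ∀ i x → unshiftAbove i (shiftAbove i x) ≡ x
unshiftAbove-shiftAbove i x with i <? x
... | no i≮x rewrite shiftAbove-≤ (ℕP.≮⇒≥ i≮x) = unshiftAbove-≤ (ℕP.≮⇒≥ i≮x)
... | yes i<x rewrite shiftAbove-> i<x = unshiftAbove-> (ℕP.m≤n⇒m≤1+n i<x)

shiftAbove-range : ∀ i n y → 1 ≤ y → y < suc n → 1 ≤ shiftAbove i y × shiftAbove i y < suc (suc n)
shiftAbove-range i n y 1≤ <suc with i <? y
... | no i≮y rewrite shiftAbove-≤ (ℕP.≮⇒≥ i≮y) = 1≤ , ℕP.m≤n⇒m≤1+n <suc
... | yes i<y rewrite shiftAbove-> i<y = s≤s z≤n , s≤s <suc

unshiftAbove-range : ∀ i n y → 1 ≤ y → y < suc (suc n) → y ≢ suc i → i < suc n →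
                     1 ≤ unshiftAbove i y × unshiftAbove i y < suc n
unshiftAbove-range i n y 1≤ <suc ne i< with i <? y
... | no i≮y rewrite unshiftAbove-≤ (ℕP.≮⇒≥ i≮y) = 1≤ , ℕP.≤-trans (s≤s (ℕP.≮⇒≥ i≮y)) i<
unshiftAbove-range i n zero    1≤ <suc ne i< | yes ()
unshiftAbove-range i n (suc y) 1≤ <suc ne i< | yes i<y rewrite unshiftAbove-> {i} {suc y} i<y =
  ℕP.≤-trans (s≤s z≤n) (ℕP.≤∧≢⇒< (ℕP.≤-pred i<y) (λ e → ne (cong suc (sym e)))) , ℕP.≤-pred <suc

prependFirst : ℕ → List ℕ → List ℕ
prependFirst i σ = suc i ∷ map (shiftAbove i) σ

prependFirst-perm : ∀ n i σ → i < suc n → IsPerm n σ → IsPerm (suc n) (prependFirst i σ)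
prependFirst-perm n i σ i< p = mkPerm (suc n) (prependFirst i σ)
  (All.tabulate (λ m e → firstFresh m e) ∷ UP.map⁺ (shiftAbove-injective i) (perm-unique p))
  sound complete
  where
  firstFresh : ∀ {z} → z ∈ map (shiftAbove i) σ → suc i ≢ z
  firstFresh m e with MP.∈-map⁻ (shiftAbove i) m
  ... | y , _ , refl = shiftAbove-skips i y (sym e)
  sound : ∀ x → x ∈ prependFirst i σ → 1 ≤ x × x < suc (suc n)
  sound x (here refl) = s≤s z≤n , s≤s i<
  sound x (there m) with MP.∈-map⁻ (shiftAbove i) m
  ... | y , y∈ , refl = let 1≤ , <suc = perm-∈⁻ p y∈ in shiftAbove-range i n y 1≤ <suc
  complete : ∀ x → 1 ≤ x → x < suc (suc n) → x ∈ prependFirst i σ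
  complete x 1≤ <suc with x ≟ suc i
  ... | yes refl = here refl
  ... | no ne = there (subst (_∈ map (shiftAbove i) σ) (shiftAbove-unshiftAbove i x ne)
                  (MP.∈-map⁺ (shiftAbove i) (let 1≤′ , <suc′ = unshiftAbove-range i n x 1≤ <suc ne i< in perm-∈⁺ p 1≤′ <suc′)))

prependFirst-injective : ∀ n i j σ τ → i < suc n → j < suc n → IsPerm n σ → IsPerm n τ →
                         prependFirst i σ ≡ prependFirst j τ → i ≡ j × σ ≡ τ
prependFirst-injective n i j σ τ _ _ _ _ e with LP.∷-injective e
... | heads , tails with ℕP.suc-injective heads
... | refl = refl , LP.map-injective (shiftAbove-injective i) tails

prependFirst-surjective : ∀ n π → IsPerm (suc n) π →
                          Σ ℕ λ i → Σ (List ℕ) λ σ → i < suc n × IsPerm n σ × prependFirst i σ ≡ π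
prependFirst-surjective n [] p with PP.↭-length p
... | ()
prependFirst-surjective n (zero ∷ τ) p with perm-∈⁻ p (here refl)
... | () , _
prependFirst-surjective n (suc i ∷ τ) p = i , map (unshiftAbove i) τ , i< , σ-perm ,
    cong (suc i ∷_) (trans (sym (LP.map-∘ τ)) (LP.map-id-local (All.tabulate (λ m → shiftAbove-unshiftAbove i _ (notFirst m)))))
  where
  i< : i < suc n
  i< = ℕP.≤-pred (proj₂ (perm-∈⁻ p (here refl)))
  τ-unique : Unique τ
  τ-unique with perm-unique p
  ... | _ ∷ u = u
  notFirst : ∀ {y} → y ∈ τ → y ≢ suc i
  notFirst {y} m e with perm-unique p
  ... | fresh ∷ _ = All.lookup fresh m (sym e)
  σ-perm : IsPerm n (map (unshiftAbove i) τ)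
  σ-perm = mkPerm n _
    (unique-map (unshiftAbove i) τ τ-unique
      (λ x y mx my e → trans (sym (shiftAbove-unshiftAbove i x (notFirst mx)))
                             (trans (cong (shiftAbove i) e) (shiftAbove-unshiftAbove i y (notFirst my)))))
    (λ z m → let y , y∈ , ez = MP.∈-map⁻ (unshiftAbove i) m
                 1≤ , <suc = perm-∈⁻ p (there y∈)
             in subst (λ w → 1 ≤ w × w < suc n) (sym ez) (unshiftAbove-range i n y 1≤ <suc (notFirst y∈) i<))
    (λ z 1≤ <suc → let 1≤′ , <suc′ = shiftAbove-range i n z 1≤ <suc
                   in subst (_∈ map (unshiftAbove i) τ) (unshiftAbove-shiftAbove i z)
                            (MP.∈-map⁺ (unshiftAbove i) (inTail z (perm-∈⁺ p 1≤′ <suc′))))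
    where
    inTail : ∀ z → shiftAbove i z ∈ suc i ∷ τ → shiftAbove i z ∈ τ
    inTail z (here e) = ⊥-elim (shiftAbove-skips i z e)
    inTail z (there m) = m

module FirstEntry (n : ℕ) =
  CountByBijection n prependFirst (prependFirst-perm n) (prependFirst-injective n) (prependFirst-surjective n)

startsUpWith? : (k : ℕ) → Decidable (λ (π : List ℕ) → Up π × (nth π 0 ≡ just k))
startsUpWith? k π = up? π ×-dec MaybeP.≡-dec _≟_ (nth π 0) (just k)

UpEntringer : ℕ → ℕ → ℕ
UpEntringer n k = count (startsUpWith? k) (perms n)

down-shift⁺ : ∀ i σ → Down σ → Down (map (shiftAbove i) σ)
up-shift⁺   : ∀ i σ → Up σ → Up (map (shiftAbove i) σ)
down-shift⁺ i [] _ = d[]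
down-shift⁺ i (x ∷ []) _ = d[x]
down-shift⁺ i (x ∷ y ∷ ys) (d∷ x>y rest) = d∷ (shiftAbove-mono i x>y) (up-shift⁺ i (y ∷ ys) rest)
up-shift⁺ i [] _ = u[]
up-shift⁺ i (x ∷ []) _ = u[x]
up-shift⁺ i (x ∷ y ∷ ys) (u∷ x<y rest) = u∷ (shiftAbove-mono i x<y) (down-shift⁺ i (y ∷ ys) rest)

down-shift⁻ : ∀ i σ → Down (map (shiftAbove i) σ) → Down σ
up-shift⁻   : ∀ i σ → Up (map (shiftAbove i) σ) → Up σ
down-shift⁻ i [] _ = d[]
down-shift⁻ i (x ∷ []) _ = d[x]
down-shift⁻ i (x ∷ y ∷ ys) (d∷ x>y rest) = d∷ (shiftAbove-reflects i x>y) (up-shift⁻ i (y ∷ ys) rest)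
up-shift⁻ i [] _ = u[]
up-shift⁻ i (x ∷ []) _ = u[x]
up-shift⁻ i (x ∷ y ∷ ys) (u∷ x<y rest) = u∷ (shiftAbove-reflects i x<y) (down-shift⁻ i (y ∷ ys) rest)

-- the first entry of a list (0 for the empty list), used as a statistic
first : List ℕ → ℕ
first []      = 0
first (x ∷ _) = x

nonempty : ∀ {n σ} → 1 ≤ n → IsPerm n σ → Σ ℕ λ y → Σ (List ℕ) λ σ′ → σ ≡ y ∷ σ′
nonempty {σ = []} (s≤s z≤n) p with perm-length p
... | ()
nonempty {σ = y ∷ σ′} _ _ = y , σ′ , refl

count-first : ∀ {Q : Pred (List ℕ) 0ℓ} (Q? : Decidable Q) n j (Q∧first? : Decidable (λ π → Q π × nth π 0 ≡ just j)) →
              1 ≤ n → count (Statistic.value? Q? first j) (perms n) ≡ count Q∧first? (perms n)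
count-first {Q} Q? n j Q∧first? 1≤n = count-⇔ _ _ (perms n) λ σ m → byCase σ (perms-sound n σ m)
  where
  byCase : ∀ σ → IsPerm n σ → Statistic.Value Q? first j σ ⇔ (Q σ × nth σ 0 ≡ just j)
  byCase σ p with nonempty 1≤n p
  ... | y , σ′ , refl = mk⇔ (λ { (q , refl) → q , refl }) (λ { (q , refl) → q , refl })

prependFirst-first : ∀ i k σ → nth (prependFirst i σ) 0 ≡ just (suc k) → i ≡ k
prependFirst-first i k σ e = ℕP.suc-injective (MaybeP.just-injective e)

prependFirst-down : ∀ i y σ → 1 ≤ y →
  Down (prependFirst i (y ∷ σ)) ⇔ (Up (y ∷ σ) × (1 ≤ y × y < suc i))
prependFirst-down i y σ 1≤y = mk⇔ to from
  where
  to : Down (prependFirst i (y ∷ σ)) → Up (y ∷ σ) × (1 ≤ y × y < suc i)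
  to (d∷ descent rest) = up-shift⁻ i (y ∷ σ) rest , 1≤y , below
    where
    below : y < suc i
    below with i <? y
    ... | no i≮y  = s≤s (ℕP.≮⇒≥ i≮y)
    ... | yes i<y = ⊥-elim (ℕP.<-asym descent (subst (suc i <_) (sym (shiftAbove-> i<y)) (s≤s i<y)))
  from : Up (y ∷ σ) × (1 ≤ y × y < suc i) → Down (prependFirst i (y ∷ σ))
  from (up , _ , y<) = d∷ (subst (_< suc i) (sym (shiftAbove-≤ (ℕP.≤-pred y<))) y<) (up-shift⁺ i (y ∷ σ) up)

prependFirst-up : ∀ n i y σ → y < suc n →
  Up (prependFirst i (y ∷ σ)) ⇔ (Down (y ∷ σ) × (suc i ≤ y × y < suc n))
prependFirst-up n i y σ y< = mk⇔ to from
  where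
  to : Up (prependFirst i (y ∷ σ)) → Down (y ∷ σ) × (suc i ≤ y × y < suc n)
  to (u∷ ascent rest) = down-shift⁻ i (y ∷ σ) rest , above , y<
    where
    above : suc i ≤ y
    above with i <? y
    ... | yes i<y = i<y
    ... | no i≮y  = ⊥-elim (ℕP.<⇒≱ ascent (ℕP.m≤n⇒m≤1+n (subst (_≤ i) (sym (shiftAbove-≤ (ℕP.≮⇒≥ i≮y))) (ℕP.≮⇒≥ i≮y))))
  from : Down (y ∷ σ) × (suc i ≤ y × y < suc n) → Up (prependFirst i (y ∷ σ))
  from (down , i<y , _) = u∷ (subst (suc i <_) (sym (shiftAbove-> i<y)) (s≤s i<y)) (down-shift⁺ i (y ∷ σ) down)

entringer-recurrence : ∀ n i → 1 ≤ n → i ≤ n → Entringer (suc n) (suc i) ≡ sumRange (UpEntringer n) 1 (suc i)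
entringer-recurrence n i 1≤n i≤n =
  begin
    Entringer (suc n) (suc i)
  ≡⟨ FirstEntry.count-byBijection-at n (startsWith? (suc i)) i (s≤s i≤n) (λ j σ _ _ h → prependFirst-first j i σ (proj₂ h)) ⟩
    count (λ σ → startsWith? (suc i) (prependFirst i σ)) (perms n)
  ≡⟨ count-⇔ _ (valueIn? 1 (suc i)) (perms n) (λ σ m → byCase σ (perms-sound n σ m)) ⟩
    count (valueIn? 1 (suc i)) (perms n)
  ≡⟨ count-valueIn (perms n) 1 (suc i) (s≤s z≤n) ⟩
    sumRange (λ j → count (value? j) (perms n)) 1 (suc i)
  ≡⟨ sumRange-cong _ _ 1 (suc i) (λ j _ _ → count-first up? n j (startsUpWith? j) 1≤n) ⟩
    sumRange (UpEntringer n) 1 (suc i)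
  ∎
  where
  open ≡-Reasoning
  open Statistic up? first
  byCase : ∀ σ → IsPerm n σ → (Down (prependFirst i σ) × nth (prependFirst i σ) 0 ≡ just (suc i)) ⇔ ValueIn 1 (suc i) σ
  byCase σ p with nonempty 1≤n p
  ... | y , σ′ , refl =
    let down⇔ = prependFirst-down i y σ′ (proj₁ (perm-∈⁻ p (here refl)))
    in mk⇔ (λ (d , _) → Equivalence.to down⇔ d) (λ v → Equivalence.from down⇔ v , refl)

upEntringer-recurrence : ∀ n i → 1 ≤ n → i ≤ n → UpEntringer (suc n) (suc i) ≡ sumRange (Entringer n) (suc i) (suc n)
upEntringer-recurrence n i 1≤n i≤n =
  begin
    UpEntringer (suc n) (suc i)
  ≡⟨ FirstEntry.count-byBijection-at n (startsUpWith? (suc i)) i (s≤s i≤n) (λ j σ _ _ h → prependFirst-first j i σ (proj₂ h)) ⟩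
    count (λ σ → startsUpWith? (suc i) (prependFirst i σ)) (perms n)
  ≡⟨ count-⇔ _ (valueIn? (suc i) (suc n)) (perms n) (λ σ m → byCase σ (perms-sound n σ m)) ⟩
    count (valueIn? (suc i) (suc n)) (perms n)
  ≡⟨ count-valueIn (perms n) (suc i) (suc n) (s≤s i≤n) ⟩
    sumRange (λ j → count (value? j) (perms n)) (suc i) (suc n)
  ≡⟨ sumRange-cong _ _ (suc i) (suc n) (λ j _ _ → count-first down? n j (startsWith? j) 1≤n) ⟩
    sumRange (Entringer n) (suc i) (suc n)
  ∎
  where
  open ≡-Reasoning
  open Statistic down? first
  byCase : ∀ σ → IsPerm n σ → (Up (prependFirst i σ) × nth (prependFirst i σ) 0 ≡ just (suc i)) ⇔ ValueIn (suc i) (suc n) σ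
  byCase σ p with nonempty 1≤n p
  ... | y , σ′ , refl =
    let up⇔ = prependFirst-up n i y σ′ (proj₂ (perm-∈⁻ p (here refl)))
    in mk⇔ (λ (u , _) → Equivalence.to up⇔ u) (λ v → Equivalence.from up⇔ v , refl)

NoPop : ℕ → List ℕ → Set
NoPop m []      = ⊤
NoPop m (x ∷ _) = x ≢ m

popAll-noPop : ∀ st m → NoPop m st → popAll st m ≡ (st , m)
popAll-noPop []       m _  = refl
popAll-noPop (x ∷ st) m np with x ≟ m
... | yes e = ⊥-elim (np e)
... | no _  = refl

popAll-top : ∀ st m → popAll (m ∷ st) m ≡ popAll st (suc m)
popAll-top st m with m ≟ m
... | yes _ = refl
... | no ne = ⊥-elim (ne refl)

pass-∷ : ∀ x xs st m → pass (x ∷ xs) st m ≡ pass xs (x ∷ proj₁ (popAll st m)) (proj₂ (popAll st m))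
pass-∷ x xs st m with popAll st m
... | _ , _ = refl

popAll-mono : ∀ st m → m ≤ proj₂ (popAll st m)
popAll-mono []       m = ℕP.≤-refl
popAll-mono (x ∷ st) m with x ≟ m
... | yes _ = ℕP.<⇒≤ (popAll-mono st (suc m))
... | no _  = ℕP.≤-refl

pass-mono-popAll : ∀ xs st m → proj₂ (popAll st m) ≤ proj₂ (pass xs st m)
pass-mono : ∀ xs st m → m ≤ proj₂ (pass xs st m)
pass-mono-popAll []       st m = ℕP.≤-refl
pass-mono-popAll (x ∷ xs) st m rewrite pass-∷ x xs st m = pass-mono xs _ _
pass-mono xs st m = ℕP.≤-trans (popAll-mono st m) (pass-mono-popAll xs st m)

reverse-∷-++ : ∀ (x : ℕ) xs st → reverse (x ∷ xs) ++ st ≡ reverse xs ++ x ∷ st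
reverse-∷-++ x xs st rewrite LP.unfold-reverse x xs = LP.++-assoc (reverse xs) [ x ] st

pass-pushes : ∀ xs ys st m → All (_≢ m) xs → NoPop m st → pass (xs ++ ys) st m ≡ pass ys (reverse xs ++ st) m
pass-pushes []       ys st m _          _  = refl
pass-pushes (x ∷ xs) ys st m (x≢m ∷ xs≢m) np rewrite pass-∷ x (xs ++ ys) st m | popAll-noPop st m np =
  trans (pass-pushes xs ys (x ∷ st) m xs≢m x≢m) (cong (λ z → pass ys z m) (sym (reverse-∷-++ x xs st)))

noPop-reverse : ∀ xs st m → All (_≢ m) xs → NoPop m st → NoPop m (reverse xs ++ st)
noPop-reverse []       st m _          np = np
noPop-reverse (x ∷ xs) st m (x≢m ∷ xs≢m) np =
  subst (NoPop m) (sym (reverse-∷-++ x xs st)) (noPop-reverse xs (x ∷ st) m xs≢m x≢m)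

pass-outputsTop : ∀ xs st m → suc m ≤ proj₂ (pass xs (m ∷ st) m)
pass-outputsTop xs st m =
  ℕP.≤-trans (subst (λ z → suc m ≤ proj₂ z) (sym (popAll-top st m)) (popAll-mono st (suc m)))
             (pass-mono-popAll xs (m ∷ st) m)

pass-outputsInput : ∀ inp st m → m ∈ inp → suc m ≤ proj₂ (pass inp st m)
pass-outputsInput (x ∷ xs) st m m∈ rewrite pass-∷ x xs st m with popAll st m | popAll-mono st m
... | st′ , m′ | m≤m′ with m ≟ m′
... | no m≢m′ = ℕP.≤-trans (ℕP.≤∧≢⇒< m≤m′ m≢m′) (pass-mono xs (x ∷ st′) m′)
pass-outputsInput (x ∷ xs) st m (here refl) | st′ , m′ | _ | yes refl = pass-outputsTop xs st′ m
pass-outputsInput (x ∷ xs) st m (there m∈) | st′ , m′ | _ | yes refl = pass-outputsInput xs (x ∷ st′) m m∈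

pass-outputsTopThenInput : ∀ B S m → suc m ∈ B → suc (suc m) ≤ proj₂ (pass B (m ∷ S) m)
pass-outputsTopThenInput (b ∷ B) S m m+1∈ rewrite pass-∷ b B (m ∷ S) m | popAll-top S m
  with popAll S (suc m) | popAll-mono S (suc m)
... | S′ , m′ | m+1≤m′ with suc m ≟ m′
... | no ne = ℕP.≤-trans (ℕP.≤∧≢⇒< m+1≤m′ ne) (pass-mono B (b ∷ S′) m′)
pass-outputsTopThenInput (b ∷ B) S m (here refl) | S′ , m′ | _ | yes refl = pass-outputsTop B S′ (suc m)
pass-outputsTopThenInput (b ∷ B) S m (there m+1∈) | S′ , m′ | _ | yes refl = pass-outputsInput B (b ∷ S′) (suc m) m+1∈

pass-outputsTopTwo : ∀ ys S m → suc (suc m) ≤ proj₂ (pass ys (m ∷ suc m ∷ S) m)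
pass-outputsTopTwo ys S m = ℕP.≤-trans popsTwo (pass-mono-popAll ys (m ∷ suc m ∷ S) m)
  where
  popsTwo : suc (suc m) ≤ proj₂ (popAll (m ∷ suc m ∷ S) m)
  popsTwo rewrite popAll-top (suc m ∷ S) m | popAll-top S (suc m) = popAll-mono S (suc (suc m))

valuesFrom : ℕ → ℕ → List ℕ
valuesFrom m T = interval m (T ∸ m)

valuesFrom-∷ : ∀ m T → m < T → valuesFrom m T ≡ m ∷ valuesFrom (suc m) T
valuesFrom-∷ m (suc T) (s≤s m≤T) rewrite suc-∸ m≤T = refl

valuesFrom-empty : ∀ m T → T ≤ m → valuesFrom m T ≡ []
valuesFrom-empty m T T≤m rewrite ℕP.m≤n⇒m∸n≡0 T≤m = refl

popAll-invariant : ∀ inp st m T → (inp ++ st) ↭ valuesFrom m T →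
  let (st′ , m′) = popAll st m in ((inp ++ st′) ↭ valuesFrom m′ T) × NoPop m′ st′
popAll-invariant inp [] m T p = p , tt
popAll-invariant inp (x ∷ st) m T p with x ≟ m
... | no ne = p , ne
... | yes refl with x <? T
... | yes x<T = popAll-invariant inp st (suc x) T
   (PP.drop-∷ (↭-trans (↭-sym (PP.shift x inp st)) (↭-trans p (↭-reflexive (valuesFrom-∷ x T x<T)))))
... | no x≮T with PP.↭-length (↭-trans p (↭-reflexive (valuesFrom-empty x T (ℕP.≮⇒≥ x≮T))))
... | e rewrite LP.length-++ inp {x ∷ st} = ⊥-elim (ℕP.1+n≢0 (trans (sym (ℕP.+-suc (length inp) (length st))) e))

pass-invariant : ∀ inp st m T → (inp ++ st) ↭ valuesFrom m T →
  let (st′ , m′) = pass inp st m in (st′ ↭ valuesFrom m′ T) × NoPop m′ st′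
pass-invariant [] st m T p = popAll-invariant [] st m T p
pass-invariant (x ∷ xs) st m T p rewrite pass-∷ x xs st m with popAll st m | popAll-invariant (x ∷ xs) st m T p
... | st′ , m′ | q , _ = pass-invariant xs (x ∷ st′) m′ T (↭-trans (PP.shift x xs st′) q)

pass-progress : ∀ s m T → s ↭ valuesFrom m T → m < T →
  let (st′ , m′) = pass s [] m in (st′ ↭ valuesFrom m′ T) × suc m ≤ m′ × NoPop m′ st′
pass-progress s m T p m<T =
  let q , np = pass-invariant s [] m T (↭-trans (↭-reflexive (LP.++-identityʳ s)) p)
  in q , pass-outputsInput s [] m (PP.∈-resp-↭ (↭-sym p) (subst (m ∈_) (sym (valuesFrom-∷ m T m<T)) (here refl))) , np

stuck-two : ∀ x st m T → (x ∷ st) ↭ valuesFrom m T → NoPop m (x ∷ st) → 2 ≤ T ∸ m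
stuck-two x st m T p np with T ∸ m in eq
... | zero with PP.↭-length p
...   | e rewrite interval-length m 0 = ⊥-elim (ℕP.1+n≢0 e)
stuck-two x st m T p np | suc zero with PP.↭-singleton-inv p
... | refl = ⊥-elim (np refl)
stuck-two x st m T p np | suc (suc _) = s≤s (s≤s z≤n)

afterPass : ℕ → List ℕ × ℕ → Maybe ℕ
afterPass fuel ([] , _)     = just 0
afterPass fuel (x ∷ st , m) = Maybe.map suc (returns fuel (x ∷ st) m)

returns-unfold : ∀ fuel inp m → returns (suc fuel) inp m ≡ afterPass fuel (pass inp [] m)
returns-unfold fuel inp m with pass inp [] m
... | [] , _ = refl
... | x ∷ st , m′ with returns fuel (x ∷ st) m′
...   | just _  = refl
...   | nothing = refl

-- Every pass outputs at least one value, so with v ≥ 2 values left at most v-2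
-- further returns happen.
-- at least two values left means m < T
two⇒< : ∀ m T → 2 ≤ T ∸ m → m < T
two⇒< m T two = ℕP.m∸n≢0⇒n<m (ℕP.m<n⇒n≢0 two)

returns-bound : ∀ fuel s m T r → s ↭ valuesFrom m T → 2 ≤ T ∸ m → returns fuel s m ≡ just r → r + 2 ≤ T ∸ m
returns-bound zero s m T r p two ()
returns-bound (suc fuel) s m T r p two e rewrite returns-unfold fuel s m
  with pass s [] m | pass-progress s m T p (two⇒< m T two)
... | [] , m′ | _ with e
...   | refl = two
returns-bound (suc fuel) s m T r p two e | x ∷ st , m′ | q , m<m′ , np with returns fuel (x ∷ st) m′ in eq
... | nothing with e
...   | ()
returns-bound (suc fuel) s m T r p two e | x ∷ st , m′ | q , m<m′ , np | just r′ with e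
... | refl = subst (suc (r′ + 2) ≤_) (sym (∸-suc (two⇒< m T two)))
               (s≤s (ℕP.≤-trans (returns-bound fuel (x ∷ st) m′ T r′ q (stuck-two x st m′ T q np) eq)
                                (ℕP.∸-monoʳ-≤ T m<m′)))

-- The procedure only compares values with m, so shifting all values and m by one
-- changes nothing.
popAll-suc : ∀ st m → popAll (map suc st) (suc m) ≡ (map suc (proj₁ (popAll st m)) , suc (proj₂ (popAll st m)))
popAll-suc [] m = refl
popAll-suc (x ∷ st) m with x ≟ m | suc x ≟ suc m
... | yes _ | yes _ = popAll-suc st (suc m)
... | no _  | no _  = refl
... | yes e | no ne = ⊥-elim (ne (cong suc e))
... | no ne | yes e = ⊥-elim (ne (ℕP.suc-injective e))

pass-suc : ∀ inp st m → pass (map suc inp) (map suc st) (suc m) ≡ (map suc (proj₁ (pass inp st m)) , suc (proj₂ (pass inp st m)))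
pass-suc [] st m = popAll-suc st m
pass-suc (x ∷ xs) st m rewrite pass-∷ (suc x) (map suc xs) (map suc st) (suc m) | popAll-suc st m | pass-∷ x xs st m =
  pass-suc xs (x ∷ proj₁ (popAll st m)) (proj₂ (popAll st m))

returns-suc : ∀ fuel s m → returns fuel (map suc s) (suc m) ≡ returns fuel s m
returns-suc zero s m = refl
returns-suc (suc fuel) s m rewrite returns-unfold fuel (map suc s) (suc m) | returns-unfold fuel s m | pass-suc s [] m
  with pass s [] m
... | [] , _ = refl
... | x ∷ st , m′ = cong (Maybe.map suc) (returns-suc fuel (x ∷ st) m′)

insertAt : ℕ → ℕ → List ℕ → List ℕ
insertAt zero    x ys       = x ∷ ys
insertAt (suc i) x []       = x ∷ []
insertAt (suc i) x (y ∷ ys) = y ∷ insertAt i x ys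

insertAt-↭ : ∀ i x ys → insertAt i x ys ↭ x ∷ ys
insertAt-↭ zero    x ys       = ↭-refl
insertAt-↭ (suc i) x []       = ↭-refl
insertAt-↭ (suc i) x (y ∷ ys) = ↭-trans (↭-prep y (insertAt-↭ i x ys)) (↭-swap y x ↭-refl)

insertAt-split : ∀ i x ys → i ≤ length ys →
  Σ (List ℕ) λ A → Σ (List ℕ) λ B → ys ≡ A ++ B × length A ≡ i × insertAt i x ys ≡ A ++ x ∷ B
insertAt-split zero x ys _ = [] , ys , refl , refl , refl
insertAt-split (suc i) x (y ∷ ys) (s≤s i≤) with insertAt-split i x ys i≤
... | A , B , ys≡ , lenA , ins≡ = y ∷ A , B , cong (y ∷_) ys≡ , cong suc lenA , cong (y ∷_) ins≡

insertAt-++ : ∀ (U : List ℕ) j x W → insertAt (length U + j) x (U ++ W) ≡ U ++ insertAt j x W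
insertAt-++ []      j x W = refl
insertAt-++ (u ∷ U) j x W = cong (u ∷_) (insertAt-++ U j x W)

insertAt-++ˡ : ∀ i x (U W : List ℕ) → i ≤ length U → insertAt i x (U ++ W) ≡ insertAt i x U ++ W
insertAt-++ˡ zero    x U       W _        = refl
insertAt-++ˡ (suc i) x (u ∷ U) W (s≤s i≤) = cong (u ∷_) (insertAt-++ˡ i x U W i≤)

removeAt : ℕ → List ℕ → List ℕ
removeAt i       []       = []
removeAt zero    (_ ∷ ys) = ys
removeAt (suc i) (y ∷ ys) = y ∷ removeAt i ys

removeAt-insertAt : ∀ i x ys → i ≤ length ys → removeAt i (insertAt i x ys) ≡ ys
removeAt-insertAt zero    x ys       _        = refl
removeAt-insertAt (suc i) x (y ∷ ys) (s≤s i≤) = cong (y ∷_) (removeAt-insertAt i x ys i≤)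

positionOfOne : List ℕ → ℕ
positionOfOne [] = 0
positionOfOne (x ∷ xs) with x ≟ 1
... | yes _ = 0
... | no _  = suc (positionOfOne xs)

positionOfOne-split : ∀ A C → All (_≢ 1) A → positionOfOne (A ++ 1 ∷ C) ≡ length A
positionOfOne-split []      C _ = refl
positionOfOne-split (y ∷ A) C (y≢1 ∷ A≢1) with y ≟ 1
... | yes e = ⊥-elim (y≢1 e)
... | no _  = cong suc (positionOfOne-split A C A≢1)

positionOfOne-insertAt : ∀ i ys → All (_≢ 1) ys → i ≤ length ys → positionOfOne (insertAt i 1 ys) ≡ i
positionOfOne-insertAt i ys ys≢1 i≤ with insertAt-split i 1 ys i≤
... | A , B , refl , refl , ins≡ rewrite ins≡ = positionOfOne-split A B (AllP.++⁻ˡ A ys≢1)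

nth-positionOfOne : ∀ {n} π j → IsPerm n π → 1 ≤ n →
                    nth π j ≡ just 1 ⇔ positionOfOne π ≡ j
nth-positionOfOne π j p 1≤n with splitAtOne π p 1≤n
... | A , C , refl , A≢1 , C≢1 rewrite positionOfOne-split A C A≢1 =
  mk⇔ (λ e → sym (index-of-1 A j A≢1 e)) (λ { refl → at-1 A })
  where
  at-1 : ∀ A → nth (A ++ 1 ∷ C) (length A) ≡ just 1
  at-1 []      = refl
  at-1 (_ ∷ A) = at-1 A
  nth-∈ : ∀ xs j {x} → nth xs j ≡ just x → x ∈ xs
  nth-∈ (y ∷ xs) zero    refl = here refl
  nth-∈ (y ∷ xs) (suc j) e    = there (nth-∈ xs j e)
  index-of-1 : ∀ A j → All (_≢ 1) A → nth (A ++ 1 ∷ C) j ≡ just 1 → j ≡ length A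
  index-of-1 []      zero    _             _ = refl
  index-of-1 []      (suc j) _             e = ⊥-elim (All.lookup C≢1 (nth-∈ C j e) refl)
  index-of-1 (y ∷ A) zero    (y≢1 ∷ _)     refl = ⊥-elim (y≢1 refl)
  index-of-1 (y ∷ A) (suc j) (_ ∷ A≢1)     e = cong suc (index-of-1 A j A≢1 e)

positionOfOne<n : ∀ {n} π → IsPerm n π → 1 ≤ n → positionOfOne π < n
positionOfOne<n π p 1≤n with splitAtOne π p 1≤n
... | A , C , refl , A≢1 , _ rewrite positionOfOne-split A C A≢1 | sym (perm-length p) | LP.length-++ A {1 ∷ C} =
  ℕP.m<m+n (length A) (s≤s z≤n)

positionOfOne-reverse : ∀ {n} π → IsPerm n π → 1 ≤ n → positionOfOne (reverse π) + positionOfOne π + 1 ≡ n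
positionOfOne-reverse π p 1≤n with splitAtOne π p 1≤n
... | A , C , refl , A≢1 , C≢1
  rewrite positionOfOne-split A C A≢1 | sym (perm-length p) | LP.length-++ A {1 ∷ C}
        | LP.reverse-++ A (1 ∷ C) | LP.unfold-reverse 1 C | LP.++-assoc (reverse C) [ 1 ] (reverse A)
        | positionOfOne-split (reverse C) (reverse A) (PP.All-resp-↭ (↭-sym (PP.↭-reverse C)) C≢1) | LP.length-reverse C =
  trans (ℕP.+-comm (length C + length A) 1) (trans (cong suc (ℕP.+-comm (length C) (length A))) (sym (ℕP.+-suc (length A) (length C))))

shiftedReverse : List ℕ → List ℕ
shiftedReverse τ = map suc (reverse τ)

insertOne : ℕ → List ℕ → List ℕ
insertOne i τ = insertAt i 1 (shiftedReverse τ)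

map-suc-≢ : ∀ {m} xs → All (_≢ m) xs → All (_≢ suc m) (map suc xs)
map-suc-≢ xs xs≢m = AllP.map⁺ (All.map (λ ne e → ne (ℕP.suc-injective e)) xs≢m)

map-suc-interval : ∀ a n → map suc (interval a n) ≡ interval (suc a) n
map-suc-interval a zero    = refl
map-suc-interval a (suc n) = cong (suc a ∷_) (map-suc-interval (suc a) n)

map-pred-interval : ∀ a n → map pred (interval (suc a) n) ≡ interval a n
map-pred-interval a zero    = refl
map-pred-interval a (suc n) = cong (a ∷_) (map-pred-interval (suc a) n)

shiftedReverse-length : ∀ {n} τ → IsPerm n τ → length (shiftedReverse τ) ≡ n
shiftedReverse-length τ p = trans (LP.length-map suc (reverse τ)) (trans (LP.length-reverse τ) (perm-length p))

shiftedReverse-no1 : ∀ {n} τ → IsPerm n τ → All (_≢ 1) (shiftedReverse τ)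
shiftedReverse-no1 τ p = map-suc-≢ (reverse τ)
  (All.tabulate λ m → ℕP.m<n⇒n≢0 (proj₁ (perm-∈⁻ p (PP.∈-resp-↭ (PP.↭-reverse τ) m))))

insertOne-perm : ∀ n i τ → i < suc n → IsPerm n τ → IsPerm (suc n) (insertOne i τ)
insertOne-perm n i τ _ p =
  ↭-trans (insertAt-↭ i 1 _)
          (↭-prep 1 (↭-trans (PP.map⁺ suc (↭-trans (PP.↭-reverse τ) p)) (↭-reflexive (map-suc-interval 1 n))))

insertOne-position : ∀ n i τ → i ≤ n → IsPerm n τ → positionOfOne (insertOne i τ) ≡ i
insertOne-position n i τ i≤n p =
  positionOfOne-insertAt i (shiftedReverse τ) (shiftedReverse-no1 τ p) (subst (i ≤_) (sym (shiftedReverse-length τ p)) i≤n)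

insertOne-injective : ∀ n i j σ τ → i < suc n → j < suc n → IsPerm n σ → IsPerm n τ →
                      insertOne i σ ≡ insertOne j τ → i ≡ j × σ ≡ τ
insertOne-injective n i j σ τ i< j< pσ pτ e = i≡j , σ≡τ
  where
  i≡j : i ≡ j
  i≡j = trans (sym (insertOne-position n i σ (ℕP.≤-pred i<) pσ))
              (trans (cong positionOfOne e) (insertOne-position n j τ (ℕP.≤-pred j<) pτ))
  removeOne : ∀ k υ → k < suc n → IsPerm n υ → removeAt k (insertOne k υ) ≡ shiftedReverse υ
  removeOne k υ k< p = removeAt-insertAt k 1 (shiftedReverse υ) (subst (k ≤_) (sym (shiftedReverse-length υ p)) (ℕP.≤-pred k<))
  σ≡τ : σ ≡ τ
  σ≡τ = LP.reverse-injective (LP.map-injective ℕP.suc-injective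
          (trans (sym (removeOne i σ i< pσ)) (trans (cong (removeAt i) e)
                 (subst (λ k → removeAt k (insertOne j τ) ≡ shiftedReverse τ) (sym i≡j) (removeOne j τ j< pτ)))))

insertOne-surjective : ∀ n π → IsPerm (suc n) π →
                       Σ ℕ λ i → Σ (List ℕ) λ σ → i < suc n × IsPerm n σ × insertOne i σ ≡ π
insertOne-surjective n π p with splitAtOne π p (s≤s z≤n)
... | A , C , refl , _ , _ = length A , reverse (map pred (A ++ C)) , A< , σ-perm , reassemble
  where
  rest : A ++ C ↭ interval 2 n
  rest = PP.drop-mid A [] p
  σ-perm : IsPerm n (reverse (map pred (A ++ C)))
  σ-perm = ↭-trans (PP.↭-reverse _) (↭-trans (PP.map⁺ pred rest) (↭-reflexive (map-pred-interval 1 n)))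
  A< : length A < suc n
  A< = subst (length A <_) (trans (sym (LP.length-++ A {1 ∷ C})) (perm-length p)) (ℕP.m<m+n (length A) (s≤s z≤n))
  suc-pred : All (λ y → suc (pred y) ≡ y) (A ++ C)
  suc-pred = All.tabulate λ m → positive (proj₁ (interval-∈⁻ 2 n (PP.∈-resp-↭ rest m)))
    where positive : ∀ {y} → 2 ≤ y → suc (pred y) ≡ y
          positive {suc y} _ = refl
  insertAt-length-++ : ∀ A → insertAt (length A) 1 (A ++ C) ≡ A ++ 1 ∷ C
  insertAt-length-++ A = subst (λ k → insertAt k 1 (A ++ C) ≡ A ++ 1 ∷ C) (ℕP.+-identityʳ (length A)) (insertAt-++ A 0 1 C)
  reassemble : insertOne (length A) (reverse (map pred (A ++ C))) ≡ A ++ 1 ∷ C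
  reassemble rewrite LP.reverse-involutive (map pred (A ++ C)) | sym (LP.map-∘ {g = suc} {f = pred} (A ++ C))
                   | LP.map-id-local suc-pred = insertAt-length-++ A

module InsertOne (n : ℕ) =
  CountByBijection n insertOne (insertOne-perm n) (insertOne-injective n) (insertOne-surjective n)

pass-pushesAll : ∀ ys st m → All (_≢ m) ys → NoPop m st → pass ys st m ≡ (reverse ys ++ st , m)
pass-pushesAll ys st m ys≢m np =
  begin
    pass ys st m
  ≡⟨ cong (λ z → pass z st m) (sym (LP.++-identityʳ ys)) ⟩
    pass (ys ++ []) st m
  ≡⟨ pass-pushes ys [] st m ys≢m np ⟩
    popAll (reverse ys ++ st) m
  ≡⟨ popAll-noPop (reverse ys ++ st) m (noPop-reverse ys st m ys≢m np) ⟩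
    (reverse ys ++ st , m)
  ∎
  where open ≡-Reasoning

pass-untilOne : ∀ X B → All (_≢ 1) X → pass (X ++ 1 ∷ B) [] 1 ≡ pass B (1 ∷ reverse X) 1
pass-untilOne X B X≢1
  rewrite pass-pushes X (1 ∷ B) [] 1 X≢1 tt | LP.++-identityʳ (reverse X) | pass-∷ 1 B (reverse X) 1
        | popAll-noPop (reverse X) 1 (subst (NoPop 1) (LP.++-identityʳ (reverse X)) (noPop-reverse X [] 1 X≢1 tt)) = refl

firstPass-twoAfter : ∀ X B → All (_≢ 1) X → 2 ∈ B → 3 ≤ proj₂ (pass (X ++ 1 ∷ B) [] 1)
firstPass-twoAfter X B X≢1 2∈B rewrite pass-untilOne X B X≢1 = pass-outputsTopThenInput B (reverse X) 1 2∈B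

firstPass-twoJustBefore : ∀ U B → All (_≢ 1) U → 3 ≤ proj₂ (pass (U ++ 2 ∷ 1 ∷ B) [] 1)
firstPass-twoJustBefore U B U≢1
  rewrite sym (LP.++-assoc U [ 2 ] (1 ∷ B))
        | pass-untilOne (U ++ [ 2 ]) B (AllP.++⁺ U≢1 ((λ ()) ∷ []))
        | LP.reverse-++ U [ 2 ] = pass-outputsTopTwo B (reverse U) 1

pass-outputsOnlyTop : ∀ ys st m → NoPop (suc m) st → All (_≢ suc m) ys → pass ys (m ∷ st) m ≡ (reverse ys ++ st , suc m)
pass-outputsOnlyTop []       st m np _ rewrite popAll-top st m = popAll-noPop st (suc m) np
pass-outputsOnlyTop (y ∷ ys) st m np (y≢ ∷ ys≢)
  rewrite pass-∷ y ys (m ∷ st) m | popAll-top st m | popAll-noPop st (suc m) np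
        | pass-pushesAll ys (y ∷ st) (suc m) ys≢ y≢ = cong (_, suc m) (sym (reverse-∷-++ y ys st))

noPop-reverse-last : ∀ U z v P m → All (_≢ m) (v ∷ P) → NoPop m (reverse (U ++ z ∷ v ∷ P))
noPop-reverse-last U z v P m (v≢ ∷ P≢)
  rewrite LP.reverse-++ U (z ∷ v ∷ P) | reverse-∷-++ z (v ∷ P) (reverse U) | reverse-∷-++ v P (z ∷ reverse U) =
  noPop-reverse P (v ∷ z ∷ reverse U) m P≢ v≢

firstPass-onlyOne : ∀ X Q → All (_≢ 1) X → NoPop 2 (reverse X) → All (_≢ 2) Q →
                    pass (X ++ 1 ∷ Q) [] 1 ≡ (reverse (X ++ Q) , 2)
firstPass-onlyOne X Q X≢1 np Q≢2
  rewrite pass-untilOne X Q X≢1 | pass-outputsOnlyTop Q (reverse X) 1 np Q≢2 =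
  cong (_, 2) (sym (LP.reverse-++ X Q))

firstPass-insertEarly : ∀ U V i → All (_≢ 1) U → i ≤ length U → 3 ≤ proj₂ (pass (insertAt i 1 (U ++ 2 ∷ V)) [] 1)
firstPass-insertEarly U V i U≢1 i≤ with insertAt-split i 1 U i≤
... | A , B , refl , _ , ins≡
  rewrite insertAt-++ˡ i 1 (A ++ B) (2 ∷ V) i≤ | ins≡ | LP.++-assoc A (1 ∷ B) (2 ∷ V) =
  firstPass-twoAfter A (B ++ 2 ∷ V) (AllP.++⁻ˡ A U≢1) (MP.∈-++⁺ʳ B (here refl))

firstPass-insertAdjacent : ∀ U V → All (_≢ 1) U → 3 ≤ proj₂ (pass (insertAt (length U + 1) 1 (U ++ 2 ∷ V)) [] 1)
firstPass-insertAdjacent U V U≢1 rewrite insertAt-++ U 1 1 (2 ∷ V) = firstPass-twoJustBefore U V U≢1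

firstPass-insertLate : ∀ U v V j → All (_≢ 1) (U ++ 2 ∷ v ∷ V) → All (_≢ 2) (v ∷ V) → j ≤ length V →
                       pass (insertAt (length U + suc (suc j)) 1 (U ++ 2 ∷ v ∷ V)) [] 1 ≡ (reverse (U ++ 2 ∷ v ∷ V) , 2)
firstPass-insertLate U v V j σ≢1 vV≢2 j≤ with insertAt-split j 1 V j≤
... | P , Q , refl , _ , ins≡ rewrite insertAt-++ U (suc (suc j)) 1 (2 ∷ v ∷ P ++ Q) | ins≡ =
  begin
    pass (U ++ 2 ∷ v ∷ P ++ 1 ∷ Q) [] 1
  ≡⟨ cong (λ z → pass z [] 1) (LP.++-assoc U (2 ∷ v ∷ P) (1 ∷ Q)) ⟨
    pass (X ++ 1 ∷ Q) [] 1
  ≡⟨ firstPass-onlyOne X Q X≢1 (noPop-reverse-last U 2 v P 2 (AllP.++⁻ˡ (v ∷ P) vV≢2)) (AllP.++⁻ʳ (v ∷ P) vV≢2) ⟩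
    (reverse (X ++ Q) , 2)
  ≡⟨ cong (λ z → reverse z , 2) (LP.++-assoc U (2 ∷ v ∷ P) Q) ⟩
    (reverse (U ++ 2 ∷ v ∷ P ++ Q) , 2)
  ∎
  where
  open ≡-Reasoning
  X : List ℕ
  X = U ++ 2 ∷ v ∷ P
  X≢1 : All (_≢ 1) X
  X≢1 = AllP.++⁻ˡ X (subst (All (_≢ 1)) (sym (LP.++-assoc U (2 ∷ v ∷ P) Q)) σ≢1)

index-beyond : ∀ a i → suc (suc a) ≤ i → a + suc (suc (i ∸ suc (suc a))) ≡ i
index-beyond a i le = trans (ℕP.+-suc a _) (trans (cong suc (ℕP.+-suc a _)) (ℕP.m+[n∸m]≡n le))

FirstPassOutcome : ℕ → ℕ → List ℕ → Set
FirstPassOutcome i t σ =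
  (suc (suc t) ≤ i × pass (insertAt i 1 σ) [] 1 ≡ (reverse σ , 2))
  ⊎ (i < suc (suc t) × 3 ≤ proj₂ (pass (insertAt i 1 σ) [] 1))

firstPass-insert : ∀ U V i → All (_≢ 1) (U ++ 2 ∷ V) → All (_≢ 2) V → i ≤ length U + suc (length V) →
                   FirstPassOutcome i (length U) (U ++ 2 ∷ V)
firstPass-insert U V i σ≢1 V≢2 i≤ with ℕP.<-cmp i (suc (length U))
... | tri< i<t+1 _ _ = inj₂ (ℕP.m≤n⇒m≤1+n i<t+1 , firstPass-insertEarly U V i (AllP.++⁻ˡ U σ≢1) (ℕP.≤-pred i<t+1))
... | tri≈ _ refl _ = inj₂ (ℕP.≤-refl , subst (λ k → 3 ≤ proj₂ (pass (insertAt k 1 (U ++ 2 ∷ V)) [] 1))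
                                               (ℕP.+-comm (length U) 1) (firstPass-insertAdjacent U V (AllP.++⁻ˡ U σ≢1)))
... | tri> _ _ t+1<i with V
...   | [] = ⊥-elim (ℕP.<-irrefl refl (ℕP.≤-trans t+1<i (subst (i ≤_) (ℕP.+-comm (length U) 1) i≤)))
...   | v ∷ V′ = inj₁ (t+1<i , subst (λ k → pass (insertAt k 1 (U ++ 2 ∷ v ∷ V′)) [] 1 ≡ (reverse (U ++ 2 ∷ v ∷ V′) , 2))
                                     i≡ (firstPass-insertLate U v V′ j σ≢1 V≢2 j≤))
  where
  j : ℕ
  j = i ∸ suc (suc (length U))
  i≡ : length U + suc (suc j) ≡ i
  i≡ = index-beyond (length U) i t+1<i
  j≤ : j ≤ length V′
  j≤ = ℕP.≤-pred (ℕP.≤-pred (ℕP.+-cancelˡ-≤ (length U) _ _ (subst (_≤ length U + suc (suc (length V′))) (sym i≡) i≤)))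

-- For insertOne i τ, the entry 2 of shiftedReverse τ comes from the entry 1 of reverse τ.
insertOne-firstPass : ∀ n i τ → 1 ≤ n → i ≤ n → IsPerm n τ →
                      FirstPassOutcome i (positionOfOne (reverse τ)) (shiftedReverse τ)
insertOne-firstPass n i τ 1≤n i≤n p with splitAtOne (reverse τ) (↭-trans (PP.↭-reverse τ) p) 1≤n
... | A , C , revτ≡ , A≢1 , C≢1 =
  subst₂ (FirstPassOutcome i) (sym t≡) (sym σ≡)
    (firstPass-insert U V i (subst (All (_≢ 1)) σ≡ (shiftedReverse-no1 τ p)) (map-suc-≢ C C≢1) i≤)
  where
  U V : List ℕ
  U = map suc A
  V = map suc C
  σ≡ : shiftedReverse τ ≡ U ++ 2 ∷ V
  σ≡ = trans (cong (map suc) revτ≡) (LP.map-++ suc A (1 ∷ C))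
  t≡ : positionOfOne (reverse τ) ≡ length U
  t≡ = trans (cong positionOfOne revτ≡) (trans (positionOfOne-split A C A≢1) (sym (LP.length-map suc A)))
  i≤ : i ≤ length U + suc (length V)
  i≤ = subst (i ≤_) (trans (sym (shiftedReverse-length τ p)) (trans (cong length σ≡) (LP.length-++ U))) i≤n

returns-early : ∀ fuel n π → 2 ≤ n → IsPerm (suc n) π → 3 ≤ proj₂ (pass π [] 1) → returns (suc fuel) π 1 ≢ just (n ∸ 1)
returns-early fuel n π 2≤n p 3≤m′ rewrite returns-unfold fuel π 1
  with pass π [] 1 | pass-progress π 1 (suc (suc n)) p (s≤s (s≤s z≤n)) | 3≤m′
... | [] , m′ | _ | _ = λ e → ℕP.m>n⇒m∸n≢0 2≤n (sym (MaybeP.just-injective e))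
... | x ∷ st , m′ | q , _ , np | 3≤m′ with returns fuel (x ∷ st) m′ in eq
...   | nothing = λ ()
...   | just r  = λ e → ℕP.<-irrefl (MaybeP.just-injective e) (ℕP.≤-trans r+2≤ (ℕP.≤-trans (ℕP.∸-monoʳ-≤ (suc (suc n)) 3≤m′) (ℕP.≤-reflexive (values-left n 2≤n))))
  where
  r+2≤ : suc (suc r) ≤ suc (suc n) ∸ m′
  r+2≤ = subst (_≤ suc (suc n) ∸ m′) (ℕP.+-comm r 2)
               (returns-bound fuel (x ∷ st) m′ (suc (suc n)) r q (stuck-two x st m′ (suc (suc n)) q np) eq)
  values-left : ∀ n → 2 ≤ n → suc (suc n) ∸ 3 ≡ n ∸ 1
  values-left (suc n) _ = refl

revTier-early : ∀ n π → 2 ≤ n → IsPerm (suc n) π → 3 ≤ proj₂ (pass π [] 1) → revTier π ≢ just (n ∸ 1)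
revTier-early n π = returns-early (length π) n π

reverse-shiftedReverse : ∀ τ → reverse (shiftedReverse τ) ≡ map suc τ
reverse-shiftedReverse τ = trans (sym (LP.reverse-map suc (reverse τ))) (cong (map suc) (LP.reverse-involutive τ))

revTier-late : ∀ n π τ → 1 ≤ n → IsPerm n τ → length π ≡ suc n →
               pass π [] 1 ≡ (reverse (shiftedReverse τ) , 2) → revTier π ≡ Maybe.map suc (revTier τ)
revTier-late n π τ 1≤n p len e
  rewrite len | returns-unfold (suc n) π 1 | e | reverse-shiftedReverse τ with nonempty 1≤n p
... | y , τ′ , refl =
  cong (Maybe.map suc) (trans (returns-suc (suc n) (y ∷ τ′) 1) (cong (λ l → returns (suc l) (y ∷ τ′) 1) (sym (perm-length p))))

map-suc-≡-just : ∀ (X : Maybe ℕ) k → Maybe.map suc X ≡ just (suc k) ⇔ X ≡ just k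
map-suc-≡-just (just x) k = mk⇔ (λ e → cong just (ℕP.suc-injective (MaybeP.just-injective e))) λ { refl → refl }
map-suc-≡-just nothing  k = mk⇔ (λ ()) λ ()

insertOne-revTier : ∀ n i τ → 2 ≤ n → i ≤ n → IsPerm n τ →
  revTier (insertOne i τ) ≡ just (n ∸ 1) ⇔ (suc (suc (positionOfOne (reverse τ))) ≤ i × revTier τ ≡ just (n ∸ 2))
insertOne-revTier n i τ 2≤n i≤n p with insertOne-firstPass n i τ (ℕP.<⇒≤ 2≤n) i≤n p
... | inj₁ (late , e) =
  mk⇔ (λ h → late , Equivalence.to (map-suc-≡-just (revTier τ) (n ∸ 2)) (trans (sym tier≡) (trans h n∸1≡)))
      (λ (_ , h) → trans tier≡ (trans (Equivalence.from (map-suc-≡-just (revTier τ) (n ∸ 2)) h) (sym n∸1≡)))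
  where
  n∸1≡ : just (n ∸ 1) ≡ just (suc (n ∸ 2))
  n∸1≡ = cong just (∸-suc 2≤n)
  tier≡ : revTier (insertOne i τ) ≡ Maybe.map suc (revTier τ)
  tier≡ = revTier-late n (insertOne i τ) τ (ℕP.<⇒≤ 2≤n) p
            (perm-length (insertOne-perm n i τ (s≤s i≤n) p)) e
... | inj₂ (early , 3≤) =
  mk⇔ (λ h → ⊥-elim (revTier-early n (insertOne i τ) 2≤n (insertOne-perm n i τ (s≤s i≤n) p) 3≤ h))
      (λ (late , _) → ⊥-elim (ℕP.<⇒≱ early late))

insertion-threshold : ∀ t p n k → t + p + 1 ≡ n → k ≤ n → suc (suc t) ≤ k ⇔ suc n ∸ k ≤ p
insertion-threshold t p n k e k≤n = mk⇔ to from
  where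
  n+1≡ : suc n ≡ suc (suc t) + p
  n+1≡ = trans (cong suc (sym e)) (cong suc (ℕP.+-comm (t + p) 1))
  to : suc (suc t) ≤ k → suc n ∸ k ≤ p
  to le = ℕP.m≤n+o⇒m∸n≤o (suc n) k (subst (_≤ k + p) (sym n+1≡) (ℕP.+-monoˡ-≤ p le))
  from : suc n ∸ k ≤ p → suc (suc t) ≤ k
  from le = ℕP.+-cancelʳ-≤ p (suc (suc t)) k
              (subst (_≤ k + p) n+1≡ (subst (suc n ≤_) (ℕP.+-comm p k)
                (ℕP.≤-trans (ℕP.≤-reflexive (sym (ℕP.m∸n+n≡m (ℕP.m≤n⇒m≤1+n k≤n)))) (ℕP.+-monoˡ-≤ k le))))

count-positionOfOne : ∀ n j → 1 ≤ n → count (Statistic.value? (hasRevTier? (n ∸ 2)) positionOfOne j) (perms n) ≡ Rk n j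
count-positionOfOne n j 1≤n = count-⇔ _ _ (perms n) λ τ m →
  let nth⇔ = nth-positionOfOne τ j (perms-sound n τ m) 1≤n
  in mk⇔ (λ (tier , pos) → tier , Equivalence.from nth⇔ pos) (λ (tier , nth≡) → tier , Equivalence.to nth⇔ nth≡)

rk-byPosition : ∀ n k → 2 ≤ n → k ≤ n →
                Rk (suc n) k ≡ count (Statistic.valueIn? (hasRevTier? (n ∸ 2)) positionOfOne (suc n ∸ k) n) (perms n)
rk-byPosition n k 2≤n k≤n =
  trans (InsertOne.count-byBijection-at n (revTierOneAt? (n ∸ 1) k) k (s≤s k≤n) oneAt-k)
        (count-⇔ _ _ (perms n) λ τ m → byCase τ (perms-sound n τ m))
  where
  1≤n : 1 ≤ n
  1≤n = ℕP.<⇒≤ 2≤n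
  oneAt-k : ∀ j τ → j < suc n → IsPerm n τ → revTier (insertOne j τ) ≡ just (n ∸ 1) × nth (insertOne j τ) k ≡ just 1 → j ≡ k
  oneAt-k j τ j< p (_ , nth≡) =
    trans (sym (insertOne-position n j τ (ℕP.≤-pred j<) p))
          (Equivalence.to (nth-positionOfOne (insertOne j τ) k (insertOne-perm n j τ j< p) (s≤s z≤n)) nth≡)
  byCase : ∀ τ → IsPerm n τ →
           (revTier (insertOne k τ) ≡ just (n ∸ 1) × nth (insertOne k τ) k ≡ just 1)
           ⇔ Statistic.ValueIn (hasRevTier? (n ∸ 2)) positionOfOne (suc n ∸ k) n τ
  byCase τ p =
    mk⇔ (λ (h , _) → let late , tier = Equivalence.to tier⇔ h in tier , Equivalence.to threshold⇔ late , positionOfOne<n τ p 1≤n)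
        (λ (tier , after , _) → Equivalence.from tier⇔ (Equivalence.from threshold⇔ after , tier) , nthAtK)
    where
    tier⇔ : revTier (insertOne k τ) ≡ just (n ∸ 1) ⇔ (suc (suc (positionOfOne (reverse τ))) ≤ k × revTier τ ≡ just (n ∸ 2))
    tier⇔ = insertOne-revTier n k τ 2≤n k≤n p
    threshold⇔ : suc (suc (positionOfOne (reverse τ))) ≤ k ⇔ suc n ∸ k ≤ positionOfOne τ
    threshold⇔ = insertion-threshold (positionOfOne (reverse τ)) (positionOfOne τ) n k (positionOfOne-reverse τ p 1≤n) k≤n
    nthAtK : nth (insertOne k τ) k ≡ just 1
    nthAtK = Equivalence.from (nth-positionOfOne (insertOne k τ) k (insertOne-perm n k τ (s≤s k≤n) p) (s≤s z≤n))
                              (insertOne-position n k τ k≤n p)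

-- R_{n+1,0} = 0: the entry 1 is never first
rk-zero : ∀ n → 2 ≤ n → Rk (suc n) 0 ≡ 0
rk-zero n 2≤n = trans (rk-byPosition n 0 2≤n z≤n)
  (count-none _ (perms n) λ τ _ (_ , n+1≤ , <n) → ℕP.<-asym <n (ℕP.≤-trans (s≤s ℕP.≤-refl) n+1≤))

rk-recurrence : ∀ n k → 2 ≤ n → 1 ≤ k → k ≤ n → Rk (suc n) k ≡ sumRange (Rk n) (suc n ∸ k) n
rk-recurrence n k 2≤n 1≤k k≤n =
  begin
    Rk (suc n) k
  ≡⟨ rk-byPosition n k 2≤n k≤n ⟩
    count (valueIn? (suc n ∸ k) n) (perms n)
  ≡⟨ count-valueIn (perms n) (suc n ∸ k) n lower≤n ⟩
    sumRange (λ j → count (value? j) (perms n)) (suc n ∸ k) n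
  ≡⟨ sumRange-cong _ _ (suc n ∸ k) n (λ j _ _ → count-positionOfOne n j (ℕP.<⇒≤ 2≤n)) ⟩
    sumRange (Rk n) (suc n ∸ k) n
  ∎
  where
  open ≡-Reasoning
  open Statistic (hasRevTier? (n ∸ 2)) positionOfOne
  lower≤n : suc n ∸ k ≤ n
  lower≤n = ℕP.m≤n+o⇒m∸n≤o (suc n) k (subst (suc n ≤_) (ℕP.+-comm n k) (subst (_≤ n + k) (ℕP.+-comm n 1) (ℕP.+-monoʳ-≤ n 1≤k)))

r-byPosition : ∀ n → 1 ≤ n → R n ≡ sumRange (Rk n) 0 n
r-byPosition n 1≤n =
  begin
    R n
  ≡⟨ count-⇔ _ (valueIn? 0 n) (perms n) (λ τ m → mk⇔ (λ tier → tier , z≤n , positionOfOne<n τ (perms-sound n τ m) 1≤n) proj₁) ⟩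
    count (valueIn? 0 n) (perms n)
  ≡⟨ count-valueIn (perms n) 0 n z≤n ⟩
    sumRange (λ j → count (value? j) (perms n)) 0 n
  ≡⟨ sumRange-cong _ _ 0 n (λ j _ _ → count-positionOfOne n j 1≤n) ⟩
    sumRange (Rk n) 0 n
  ∎
  where
  open ≡-Reasoning
  open Statistic (hasRevTier? (n ∸ 2)) positionOfOne

RkIsEntringer : ℕ → Set
RkIsEntringer N = ∀ k → 1 ≤ k → k ≤ N → Rk (suc N) k ≡ Entringer N k

RkIsUpEntringer : ℕ → Set
RkIsUpEntringer N = ∀ j → 1 ≤ j → j ≤ N → Rk (suc N) (suc N ∸ j) ≡ UpEntringer N j

rk-base : RkIsEntringer 2 × RkIsUpEntringer 2
rk-base = forEntringer , forUpEntringer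
  where
  forEntringer : RkIsEntringer 2
  forEntringer 1 _ _ = refl
  forEntringer 2 _ _ = refl
  forEntringer (suc (suc (suc _))) _ (s≤s (s≤s ()))
  forUpEntringer : RkIsUpEntringer 2
  forUpEntringer 1 _ _ = refl
  forUpEntringer 2 _ _ = refl
  forUpEntringer (suc (suc (suc _))) _ (s≤s (s≤s ()))

rk-step : ∀ N → 2 ≤ N → RkIsEntringer N × RkIsUpEntringer N → RkIsEntringer (suc N) × RkIsUpEntringer (suc N)
rk-step N 2≤N (isE , isU) = isE′ , isU′
  where
  open ≡-Reasoning
  1≤N : 1 ≤ N
  1≤N = ℕP.<⇒≤ 2≤N
  isE′ : RkIsEntringer (suc N)
  isE′ (suc i) 1≤k k≤ =
    begin
      Rk (suc (suc N)) (suc i)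
    ≡⟨ rk-recurrence (suc N) (suc i) (ℕP.m≤n⇒m≤1+n 2≤N) 1≤k k≤ ⟩
      sumRange (Rk (suc N)) (suc N ∸ i) (suc N)
    ≡⟨ sumRange-reflect (Rk (suc N)) (suc N) 1 i (ℕP.m≤n⇒m≤1+n k≤) ⟨
      sumRange (λ j → Rk (suc N) (suc N ∸ j)) 1 (suc i)
    ≡⟨ sumRange-cong _ _ 1 (suc i) (λ j 1≤j j< → isU j 1≤j (ℕP.≤-trans (ℕP.≤-pred j<) (ℕP.≤-pred k≤))) ⟩
      sumRange (UpEntringer N) 1 (suc i)
    ≡⟨ entringer-recurrence N i 1≤N (ℕP.≤-pred k≤) ⟨
      Entringer (suc N) (suc i)
    ∎
  isU′ : RkIsUpEntringer (suc N)
  isU′ (suc i) 1≤j j≤ =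
    begin
      Rk (suc (suc N)) (suc N ∸ i)
    ≡⟨ rk-recurrence (suc N) (suc N ∸ i) (ℕP.m≤n⇒m≤1+n 2≤N) 1≤k (ℕP.m∸n≤m (suc N) i) ⟩
      sumRange (Rk (suc N)) (suc (suc N) ∸ (suc N ∸ i)) (suc N)
    ≡⟨ cong (λ a → sumRange (Rk (suc N)) a (suc N)) (ℕP.m∸[m∸n]≡n (ℕP.m≤n⇒m≤1+n j≤)) ⟩
      sumRange (Rk (suc N)) (suc i) (suc N)
    ≡⟨ sumRange-cong _ _ (suc i) (suc N) (λ k i<k k< → isE k (ℕP.≤-trans (s≤s z≤n) i<k) (ℕP.≤-pred k<)) ⟩
      sumRange (Entringer N) (suc i) (suc N)
    ≡⟨ upEntringer-recurrence N i 1≤N (ℕP.≤-pred j≤) ⟨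
      UpEntringer (suc N) (suc i)
    ∎
    where
    1≤k : 1 ≤ suc N ∸ i
    1≤k = subst (1 ≤_) (sym (suc-∸ (ℕP.≤-pred j≤))) (s≤s z≤n)

rk≡entringer : ∀ N → 2 ≤ N → RkIsEntringer N × RkIsUpEntringer N
rk≡entringer 1 (s≤s ())
rk≡entringer 2 _ = rk-base
rk≡entringer (suc (suc (suc N))) _ = rk-step (suc (suc N)) (s≤s (s≤s z≤n)) (rk≡entringer (suc (suc N)) (s≤s (s≤s z≤n)))

r≡euler : ∀ N → 2 ≤ N → R (suc N) ≡ Euler N
r≡euler N 2≤N =
  begin
    R (suc N)
  ≡⟨ r-byPosition (suc N) (s≤s z≤n) ⟩
    sumRange (Rk (suc N)) 0 (suc N)
  ≡⟨ sumRange-cons (Rk (suc N)) 0 (suc N) (s≤s z≤n) ⟩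
    Rk (suc N) 0 + sumRange (Rk (suc N)) 1 (suc N)
  ≡⟨ cong₂ _+_ (rk-zero N 2≤N) (sumRange-cong _ _ 1 (suc N) (λ k 1≤k k< → proj₁ (rk≡entringer N 2≤N) k 1≤k (ℕP.≤-pred k<))) ⟩
    sumRange (Entringer N) 1 (suc N)
  ≡⟨ sum-upTo (λ i → Entringer N (suc i)) N ⟨
    Euler N
  ∎
  where open ≡-Reasoning

mainTheorem9 : (n : ℕ) → 3 ≤ n →
    ((k : ℕ) → 1 ≤ k → k ≤ n ∸ 1 → Rk n k ≡ Entringer (n ∸ 1) k)
    × (R n ≡ Euler (n ∸ 1))
mainTheorem9 (suc N) (s≤s 2≤N) = proj₁ (rk≡entringer N 2≤N) , r≡euler N 2≤N
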